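{- Let $n\ge3$ and let $K$ be a finite field with $q$ elements. Then \[ |C_3(n)|=\begin{cases}q^{2n}-q^{n+2}-q^{n+1}+q^3,& n\not\equiv0\pmod 3,\\ q^{2n}+2q^{n+2}+2q^{n+1}+q^3,& n\equiv0\pmod3.\end{cases} \]
   Context: $C_3(n)$ is the set of tuples $(v_1,\dots,v_n)\in(\mathbb{P}^2(K))^n$ such that for every $i\in\{1,\dots,n\}$ the points $v_i,v_{i+1},v_{i+2}$ (indices mod $n$) are projectively independent, i.e. their lifts in $K^3$ are linearly independent. -}

module Defs where

open import Level using (Level; _⊔_)
open import Algebra.Bundles using (CommutativeRing)
open import Data.Nat using (ℕ; zero; suc) renaming (_+_ to _+ℕ_)
open import Data.Nat.DivMod using (_mod_)
open import Data.Fin using (Fin; toℕ)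
open import Data.List using (List; length)
open import Data.List.Relation.Unary.All using (All)
open import Data.List.Relation.Unary.Any using (Any)
open import Data.List.Relation.Unary.AllPairs using (AllPairs)
open import Data.Product using (Σ; ∃; _×_; _,_; proj₁)
open import Relation.Nullary using (¬_)
open import Relation.Binary.PropositionalEquality using (_≡_)

record Field (c ℓ : Level) : Set (Level.suc (c ⊔ ℓ)) where
  field
    commutativeRing′ : CommutativeRing c ℓ
  open CommutativeRing commutativeRing′ public
  field
    1≉0     : ¬ (1# ≈ 0#)
    inverse : ∀ x → ¬ (x ≈ 0#) → ∃ λ y → x * y ≈ 1#

HasCardinality : ∀ {a r p} {A : Set a} → (A → A → Set r) → (A → Set p) → ℕ →
                 Set (a ⊔ r ⊔ p)
HasCardinality {A = A} _~_ P N =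
  Σ (List A) λ xs →
    length xs ≡ N ×
    All P xs ×
    AllPairs (λ x y → ¬ (x ~ y)) xs ×
    (∀ x → P x → Any (x ~_) xs)

shift : ∀ {n} → Fin n → ℕ → Fin n
shift {suc m} i k = (toℕ i +ℕ k) mod (suc m)

module _ {c ℓ : Level} (F : Field c ℓ) where
  open Field F renaming (Carrier to K)

  K³ : Set c
  K³ = K × K × K

  _≈³_ : K³ → K³ → Set ℓ
  (x₁ , x₂ , x₃) ≈³ (y₁ , y₂ , y₃) = (x₁ ≈ y₁) × (x₂ ≈ y₂) × (x₃ ≈ y₃)

  0³ : K³
  0³ = 0# , 0# , 0#

  _·³_ : K → K³ → K³
  t ·³ (x₁ , x₂ , x₃) = t * x₁ , t * x₂ , t * x₃

  _+³_ : K³ → K³ → K³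
  (x₁ , x₂ , x₃) +³ (y₁ , y₂ , y₃) = x₁ + y₁ , x₂ + y₂ , x₃ + y₃

  Lift : Set (c ⊔ ℓ)
  Lift = Σ K³ λ v → ¬ (v ≈³ 0³)

  SamePoint : Lift → Lift → Set (c ⊔ ℓ)
  SamePoint (u , _) (w , _) = ∃ λ t → ¬ (t ≈ 0#) × ((t ·³ u) ≈³ w)

  LinIndep : K³ → K³ → K³ → Set (c ⊔ ℓ)
  LinIndep u v w =
    ∀ a b d → (((a ·³ u) +³ (b ·³ v)) +³ (d ·³ w)) ≈³ 0³ →
    (a ≈ 0#) × (b ≈ 0#) × (d ≈ 0#)

  ProjIndep : Lift → Lift → Lift → Set (c ⊔ ℓ)
  ProjIndep (u , _) (v , _) (w , _) = LinIndep u v w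

  Tuple : ℕ → Set (c ⊔ ℓ)
  Tuple n = Fin n → Lift

  SameTuple : ∀ n → Tuple n → Tuple n → Set (c ⊔ ℓ)
  SameTuple n vs ws = ∀ i → SamePoint (vs i) (ws i)

  InC₃ : ∀ n → Tuple n → Set (c ⊔ ℓ)
  InC₃ n vs = ∀ i → ProjIndep (vs i) (vs (shift i 1)) (vs (shift i 2))

module Submission where

-- Represent the first two points v₀, v₁ of a configuration by one of the (q²+q+1)(q²+q) ordered
-- pairs of distinct points of ℙ²(K), with lifts A, B, and complete them to a basis (W, A, B).
-- If v_k, v_{k+1}, v_{k+2} are independent, v_{k+2} has a unique lift u₁ + β u₂ + γ u₃ with
-- respect to the frame (u₁, u₂, u₃) of lifts of v_{k-1}, v_k, v_{k+1}, so a configuration is a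
-- word of letters (β, γ) ∈ K² whose frames close up.  Closing up only depends on the coordinates
-- a of A in the last frame and on lᵢ = det(A, B, uᵢ).  Which of a₁, l₃, a₂, l₂ vanish sorts the
-- pairs (a, l) into six classes, and the number of letters moving one class to another depends
-- only on the two classes, so the count is a power of a 6 × 6 transfer matrix.  Its eigenvalues
-- q², q ζ (ζ³ = 1) and 1 give the closed form, which therefore depends on n mod 3.

open import Defs
open import Level using (Level; _⊔_)
open import Function using (_∘_)
open import Algebra.Bundles using (CommutativeRing)
open import Algebra.Bundles.Raw using (RawSemiring; RawRing)
import Algebra.Solver.Ring.AlmostCommutativeRing as ACR
open import Data.Bool using (Bool; true; false; T; if_then_else_)
open import Data.Empty using (⊥; ⊥-elim)
open import Data.Unit using (⊤; tt)
open import Data.Nat as ℕ using (ℕ; zero; suc; _<_; _≤_; s≤s; z≤n)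
import Data.Nat.Properties as ℕ
open import Data.Nat.DivMod using (_%_; _mod_; m<n⇒m%n≡m; n%n≡0; [m+n]%n≡m%n)
open import Data.Nat.ListAction using (sum)
open import Data.Nat.ListAction.Properties using (sum-++)
open import Data.Nat.Solver using (module +-*-Solver)
open import Data.Integer as ℤ using (ℤ; +_; -[1+_]; _⊖_; _◃_; sign; ∣_∣)
import Data.Integer.Properties as ℤ
import Data.Integer.Solver as ℤ-Solver
open import Data.Integer.Tactic.RingSolver using (solve-∀)
open import Data.Sign as Sign using (Sign)
open import Data.Maybe using (Maybe; just; nothing)
open import Data.Fin as Fin using (Fin; toℕ; fromℕ<)
open import Data.Fin.Properties using (toℕ-fromℕ<; toℕ-injective; toℕ<n)
open import Data.Product using (∃; _×_; _,_; proj₁; proj₂)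
open import Data.Product.Relation.Binary.Pointwise.NonDependent using (×-setoid)
open import Data.Sum using (_⊎_; inj₁; inj₂)
open import Data.List using (List; []; _∷_; [_]; length; map; concatMap; _++_; cartesianProductWith; cartesianProduct)
open import Data.List.Properties using (length-map; length-++; map-++; map-∘)
open import Data.List.Membership.Propositional using (_∈_; find)
open import Data.List.Relation.Unary.All as All using (All; []; _∷_)
import Data.List.Relation.Unary.All.Properties as All
open import Data.List.Relation.Unary.Any as Any using (Any; here; there)
import Data.List.Relation.Unary.Any.Properties as Any
open import Data.List.Relation.Unary.AllPairs as AllPairs using (AllPairs; []; _∷_)
import Data.List.Relation.Unary.AllPairs.Properties as AllPairs
import Data.List.Relation.Unary.Unique.Setoid.Properties as Unique
open import Data.Vec using (Vec; []; _∷_)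
import Data.Vec.Relation.Unary.All as Vec
open import Relation.Binary.Core using (Rel)
open import Relation.Binary.Bundles using (Setoid)
open import Relation.Binary.Definitions using (Decidable)
open import Relation.Binary.PropositionalEquality as ≡ using (_≡_)
open import Relation.Nullary using (¬_; Dec; yes; no; does; contradiction)
open import Relation.Nullary.Decidable using (dec-true; dec-false; _×-dec_)

-- Using ℤ as coefficient ring lets the normaliser cancel constants by computation; the
-- tail-call-optimised multiplication makes the constants 0 and 1 evaluate to 0# and 1#.
module ℤ-CoefficientSolver {c ℓ : Level} (R : CommutativeRing c ℓ) where
  open CommutativeRing R
  open import Algebra.Properties.Ring ring using (-‿distribˡ-*; -‿distribʳ-*; -‿involutive; -0#≈0#)
  open import Algebra.Properties.AbelianGroup +-abelianGroup using (⁻¹-∙-comm)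
  open import Algebra.Properties.Semiring.Mult.TCOptimised semiring using (×-homo-+; ×1-homo-*) renaming (_×_ to _×′_)
  open import Relation.Binary.Reasoning.Setoid setoid

  fromℕ : ℕ → Carrier
  fromℕ n = n ×′ 1#

  fromℤ : ℤ → Carrier
  fromℤ (+ n)    = fromℕ n
  fromℤ -[1+ n ] = - fromℕ (suc n)

  private
    signed : Sign → Carrier → Carrier
    signed Sign.+ x = x
    signed Sign.- x = - x

    signed-cong : ∀ s {x y} → x ≈ y → signed s x ≈ signed s y
    signed-cong Sign.+ e = e
    signed-cong Sign.- e = -‿cong e

    signed-* : ∀ s t x y → signed (s Sign.* t) (x * y) ≈ signed s x * signed t y
    signed-* Sign.+ Sign.+ x y = refl
    signed-* Sign.+ Sign.- x y = -‿distribʳ-* x y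
    signed-* Sign.- Sign.+ x y = -‿distribˡ-* x y
    signed-* Sign.- Sign.- x y = begin
      x * y       ≈⟨ -‿involutive (x * y) ⟨
      - - (x * y) ≈⟨ -‿cong (-‿distribˡ-* x y) ⟩
      - (- x * y) ≈⟨ -‿distribʳ-* (- x) y ⟩
      - x * - y   ∎

    fromℤ-◃ : ∀ s n → fromℤ (s ◃ n) ≈ signed s (fromℕ n)
    fromℤ-◃ Sign.+ zero    = refl
    fromℤ-◃ Sign.- zero    = sym -0#≈0#
    fromℤ-◃ Sign.+ (suc n) = refl
    fromℤ-◃ Sign.- (suc n) = refl

    fromℤ-sign : ∀ i → fromℤ i ≈ signed (sign i) (fromℕ ∣ i ∣)
    fromℤ-sign (+ n)    = refl
    fromℤ-sign -[1+ n ] = refl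

    [1+x]-[1+y]≈x-y : ∀ x y → (1# + x) - (1# + y) ≈ x - y
    [1+x]-[1+y]≈x-y x y = begin
      (1# + x) + - (1# + y)   ≈⟨ +-congˡ (⁻¹-∙-comm 1# y) ⟨
      (1# + x) + (- 1# + - y) ≈⟨ +-assoc 1# x _ ⟩
      1# + (x + (- 1# + - y)) ≈⟨ +-congˡ (+-assoc x (- 1#) (- y)) ⟨
      1# + ((x + - 1#) + - y) ≈⟨ +-congˡ (+-congʳ (+-comm x (- 1#))) ⟩
      1# + ((- 1# + x) + - y) ≈⟨ +-congˡ (+-assoc (- 1#) x (- y)) ⟩
      1# + (- 1# + (x + - y)) ≈⟨ +-assoc 1# (- 1#) _ ⟨
      (1# + - 1#) + (x - y)   ≈⟨ +-congʳ (-‿inverseʳ 1#) ⟩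
      0# + (x - y)            ≈⟨ +-identityˡ _ ⟩
      x - y                   ∎

    fromℤ-⊖ : ∀ m n → fromℤ (m ⊖ n) ≈ fromℕ m - fromℕ n
    fromℤ-⊖ m       zero    = trans (sym (+-identityʳ _)) (+-congˡ (sym -0#≈0#))
    fromℤ-⊖ zero    (suc n) = sym (+-identityˡ _)
    fromℤ-⊖ (suc m) (suc n) = begin
      fromℤ (suc m ⊖ suc n)                 ≡⟨ ≡.cong fromℤ (ℤ.[1+m]⊖[1+n]≡m⊖n m n) ⟩
      fromℤ (m ⊖ n)                         ≈⟨ fromℤ-⊖ m n ⟩
      fromℕ m - fromℕ n                     ≈⟨ [1+x]-[1+y]≈x-y (fromℕ m) (fromℕ n) ⟨
      (1# + fromℕ m) - (1# + fromℕ n)       ≈⟨ +-cong (×-homo-+ 1# 1 m) (-‿cong (×-homo-+ 1# 1 n)) ⟨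
      fromℕ (suc m) - fromℕ (suc n)         ∎

  fromℤ-+ : ∀ i j → fromℤ (i ℤ.+ j) ≈ fromℤ i + fromℤ j
  fromℤ-+ (+ m)    (+ n)    = ×-homo-+ 1# m n
  fromℤ-+ (+ m)    -[1+ n ] = fromℤ-⊖ m (suc n)
  fromℤ-+ -[1+ m ] (+ n)    = trans (fromℤ-⊖ n (suc m)) (+-comm _ _)
  fromℤ-+ -[1+ m ] -[1+ n ] = begin
    - fromℕ (suc (suc (m ℕ.+ n)))   ≡⟨ ≡.cong (λ k → - fromℕ (suc k)) (ℕ.+-suc m n) ⟨
    - fromℕ (suc m ℕ.+ suc n)       ≈⟨ -‿cong (×-homo-+ 1# (suc m) (suc n)) ⟩
    - (fromℕ (suc m) + fromℕ (suc n)) ≈⟨ ⁻¹-∙-comm _ _ ⟨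
    - fromℕ (suc m) + - fromℕ (suc n) ∎

  fromℤ-* : ∀ i j → fromℤ (i ℤ.* j) ≈ fromℤ i * fromℤ j
  fromℤ-* i j = begin
    fromℤ (i ℤ.* j)                                         ≈⟨ fromℤ-◃ (sign i Sign.* sign j) (∣ i ∣ ℕ.* ∣ j ∣) ⟩
    signed (sign i Sign.* sign j) (fromℕ (∣ i ∣ ℕ.* ∣ j ∣)) ≈⟨ signed-cong (sign i Sign.* sign j) (×1-homo-* ∣ i ∣ ∣ j ∣) ⟩
    signed (sign i Sign.* sign j) (fromℕ ∣ i ∣ * fromℕ ∣ j ∣) ≈⟨ signed-* (sign i) (sign j) _ _ ⟩
    signed (sign i) (fromℕ ∣ i ∣) * signed (sign j) (fromℕ ∣ j ∣) ≈⟨ *-cong (fromℤ-sign i) (fromℤ-sign j) ⟨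
    fromℤ i * fromℤ j                                       ∎

  fromℤ-neg : ∀ i → fromℤ (ℤ.- i) ≈ - fromℤ i
  fromℤ-neg (+ zero)  = sym -0#≈0#
  fromℤ-neg (+ suc n) = refl
  fromℤ-neg -[1+ n ]  = sym (-‿involutive _)

  private
    almostCommutativeRing : ACR.AlmostCommutativeRing c ℓ
    almostCommutativeRing = ACR.fromCommutativeRing R

    fromℤ-morphism : ℤ.+-*-rawRing ACR.-Raw-AlmostCommutative⟶ almostCommutativeRing
    fromℤ-morphism = record
      { ⟦_⟧    = fromℤ
      ; +-homo = fromℤ-+
      ; *-homo = fromℤ-*
      ; -‿homo = fromℤ-neg
      ; 0-homo = refl
      ; 1-homo = refl
      }

    fromℤ-≟ : ∀ i j → Maybe (fromℤ i ≈ fromℤ j)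
    fromℤ-≟ i j with i ℤ.≟ j
    ... | yes ≡.refl = just refl
    ... | no _       = nothing

  open import Algebra.Solver.Ring ℤ.+-*-rawRing almostCommutativeRing fromℤ-morphism fromℤ-≟ public

module _ {a b} {A : Set a} {B : Set b} where
  open ≡.≡-Reasoning

  length-concatMap : (f : A → List B) (xs : List A) →
                     length (concatMap f xs) ≡ sum (map (length ∘ f) xs)
  length-concatMap f []       = ≡.refl
  length-concatMap f (x ∷ xs) =
    ≡.trans (length-++ (f x)) (≡.cong (length (f x) ℕ.+_) (length-concatMap f xs))

  length-cartesianProductWith : ∀ {c} {C : Set c} (f : A → B → C) xs ys →
                                length (cartesianProductWith f xs ys) ≡ length xs ℕ.* length ys
  length-cartesianProductWith f []       ys = ≡.refl
  length-cartesianProductWith f (x ∷ xs) ys = begin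
    length (map (f x) ys ++ cartesianProductWith f xs ys)             ≡⟨ length-++ (map (f x) ys) ⟩
    length (map (f x) ys) ℕ.+ length (cartesianProductWith f xs ys)
      ≡⟨ ≡.cong₂ ℕ._+_ (length-map (f x) ys) (length-cartesianProductWith f xs ys) ⟩
    length ys ℕ.+ length xs ℕ.* length ys                             ∎

  sum-cartesianProduct : ∀ (g : A × B → ℕ) xs ys →
                         sum (map g (cartesianProduct xs ys)) ≡ sum (map (λ x → sum (map (λ y → g (x , y)) ys)) xs)
  sum-cartesianProduct g []       ys = ≡.refl
  sum-cartesianProduct g (x ∷ xs) ys = begin
    sum (map g (map (x ,_) ys ++ cartesianProduct xs ys))
      ≡⟨ ≡.cong sum (map-++ g (map (x ,_) ys) (cartesianProduct xs ys)) ⟩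
    sum (map g (map (x ,_) ys) ++ map g (cartesianProduct xs ys))
      ≡⟨ sum-++ (map g (map (x ,_) ys)) (map g (cartesianProduct xs ys)) ⟩
    sum (map g (map (x ,_) ys)) ℕ.+ sum (map g (cartesianProduct xs ys))
      ≡⟨ ≡.cong₂ ℕ._+_ (≡.cong sum (≡.sym (map-∘ ys))) (sum-cartesianProduct g xs ys) ⟩
    sum (map (λ y → g (x , y)) ys) ℕ.+ sum (map (λ x → sum (map (λ y → g (x , y)) ys)) xs) ∎

module _ {a} {A : Set a} where

  sum-map-const : ∀ (f : A → ℕ) {k xs} → All (λ x → f x ≡ k) xs → sum (map f xs) ≡ length xs ℕ.* k
  sum-map-const f []       = ≡.refl
  sum-map-const f (e ∷ es) = ≡.cong₂ ℕ._+_ e (sum-map-const f es)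

  sum-map-cong : ∀ {f g : A → ℕ} → (∀ x → f x ≡ g x) → ∀ xs → sum (map f xs) ≡ sum (map g xs)
  sum-map-cong f≗g []       = ≡.refl
  sum-map-cong f≗g (x ∷ xs) = ≡.cong₂ ℕ._+_ (f≗g x) (sum-map-cong f≗g xs)

module _ {a} {A : Set a} where

  distinctPairs : List A → List (A × A)
  distinctPairs []       = []
  distinctPairs (x ∷ xs) = map (x ,_) xs ++ map (_, x) xs ++ distinctPairs xs

  length-distinctPairs : ∀ xs → length (distinctPairs xs) ≡ length xs ℕ.* ℕ.pred (length xs)
  length-distinctPairs []       = ≡.refl
  length-distinctPairs (x ∷ xs) = begin
    length (map (x ,_) xs ++ map (_, x) xs ++ distinctPairs xs)
      ≡⟨ length-++ (map (x ,_) xs) ⟩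
    length (map (x ,_) xs) ℕ.+ length (map (_, x) xs ++ distinctPairs xs)
      ≡⟨ ≡.cong₂ ℕ._+_ (length-map _ xs) (length-++ (map (_, x) xs)) ⟩
    l ℕ.+ (length (map (_, x) xs) ℕ.+ length (distinctPairs xs))
      ≡⟨ ≡.cong (λ k → l ℕ.+ (k ℕ.+ length (distinctPairs xs))) (length-map _ xs) ⟩
    l ℕ.+ (l ℕ.+ length (distinctPairs xs))
      ≡⟨ ≡.cong (λ k → l ℕ.+ (l ℕ.+ k)) (length-distinctPairs xs) ⟩
    l ℕ.+ (l ℕ.+ l ℕ.* ℕ.pred l)
      ≡⟨ arithmetic l ⟩
    suc l ℕ.* l ∎
    where
    open ≡.≡-Reasoning
    l = length xs
    arithmetic : ∀ l → l ℕ.+ (l ℕ.+ l ℕ.* ℕ.pred l) ≡ suc l ℕ.* l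
    arithmetic zero    = ≡.refl
    arithmetic (suc k) = solve 1 (λ k → (con 1 :+ k) :+ ((con 1 :+ k) :+ (con 1 :+ k) :* k)
                                      := (con 2 :+ k) :* (con 1 :+ k)) ≡.refl k
      where open +-*-Solver

  distinctPairs-All : ∀ {p} {P : A → Set p} {xs} → All P xs →
                      All (λ xy → P (proj₁ xy) × P (proj₂ xy)) (distinctPairs xs)
  distinctPairs-All []         = []
  distinctPairs-All (px ∷ pxs) =
    All.++⁺ (All.map⁺ (All.map (px ,_) pxs))
            (All.++⁺ (All.map⁺ (All.map (_, px) pxs)) (distinctPairs-All pxs))

  module _ {r} {R : Rel A r} where

    distinctPairs-related : (∀ {x y} → R x y → R y x) → ∀ {xs} → AllPairs R xs →
                            All (λ xy → R (proj₁ xy) (proj₂ xy)) (distinctPairs xs)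
    distinctPairs-related sym []         = []
    distinctPairs-related sym (rx ∷ rxs) =
      All.++⁺ (All.map⁺ rx) (All.++⁺ (All.map⁺ (All.map sym rx)) (distinctPairs-related sym rxs))

    distinctPairs-distinct : ∀ {xs} → AllPairs R xs →
      AllPairs (λ xy uv → R (proj₁ xy) (proj₁ uv) ⊎ R (proj₂ xy) (proj₂ uv)) (distinctPairs xs)
    distinctPairs-distinct {x ∷ xs} (rx ∷ rxs) =
      AllPairs.++⁺ (AllPairs.map⁺ (AllPairs.map inj₂ rxs))
        (AllPairs.++⁺ (AllPairs.map⁺ (AllPairs.map inj₁ rxs)) (distinctPairs-distinct rxs)
           (All.map⁺ (All.map (λ _ → All.map (λ (_ , rxw) → inj₂ rxw) later) rx)))
        (All.map⁺ (All.map (λ _ → All.++⁺ (All.map⁺ (All.map inj₁ rx))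
                                          (All.map (λ (rxu , _) → inj₁ rxu) later)) rx))
      where
      later : All (λ uw → R x (proj₁ uw) × R x (proj₂ uw)) (distinctPairs xs)
      later = distinctPairs-All rx
    distinctPairs-distinct {[]} [] = []

  distinctPairs-any : ∀ {p q} {P : A → Set p} {Q : A → Set q} {xs} →
                      (∀ {x} → P x → Q x → ⊥) → Any P xs → Any Q xs →
                      Any (λ xy → P (proj₁ xy) × Q (proj₂ xy)) (distinctPairs xs)
  distinctPairs-any P∩Q=∅ (here px) (here qx) = ⊥-elim (P∩Q=∅ px qx)
  distinctPairs-any P∩Q=∅ (here px) (there qy) = Any.++⁺ˡ (Any.map⁺ (Any.map (px ,_) qy))
  distinctPairs-any {xs = x ∷ xs} P∩Q=∅ (there py) (here qx) =
    Any.++⁺ʳ (map (x ,_) xs) (Any.++⁺ˡ (Any.map⁺ (Any.map (_, qx) py)))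
  distinctPairs-any {xs = x ∷ xs} P∩Q=∅ (there py) (there qy) =
    Any.++⁺ʳ (map (x ,_) xs) (Any.++⁺ʳ (map (_, x) xs) (distinctPairs-any P∩Q=∅ py qy))

module Words {a s} {A : Set a} {S : Set s}
             (letters : List A) (step : A → S → S) (accepts : S → Bool) where

  run : ∀ {m} → S → Vec A m → S
  run s []      = s
  run s (x ∷ v) = run (step x s) v

  words : (m : ℕ) → S → List (Vec A m)
  words zero    s = if accepts s then [ [] ] else []
  words (suc m) s = concatMap (λ x → map (x ∷_) (words m (step x s))) letters

  length-words-zero : ∀ s → length (words zero s) ≡ (if accepts s then 1 else 0)
  length-words-zero s with accepts s
  ... | true  = ≡.refl
  ... | false = ≡.refl

  length-words-suc : ∀ m s → length (words (suc m) s) ≡ sum (map (λ x → length (words m (step x s))) letters)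
  length-words-suc m s = ≡.trans (length-concatMap _ letters)
                                 (sum-map-cong (λ x → length-map (x ∷_) (words m (step x s))) letters)

  words-accepted : ∀ m s → All (λ v → T (accepts (run s v))) (words m s)
  words-accepted zero    s with accepts s in accepting
  ... | true  = ≡.subst T (≡.sym accepting) tt ∷ []
  ... | false = []
  words-accepted (suc m) s = All.concat⁺ (All.map⁺ (All.universal (λ x → All.map⁺ (words-accepted m (step x s))) letters))

  ∈-words : ∀ {m} s (v : Vec A m) → Vec.All (_∈ letters) v → T (accepts (run s v)) → v ∈ words m s
  ∈-words s []      Vec.[]         acc with accepts s
  ... | true = here ≡.refl
  ∈-words s (x ∷ v) (x∈ Vec.∷ v∈) acc =
    Any.concatMap⁺ _ (Any.map (λ { ≡.refl → Any.map⁺ (Any.map (≡.cong (x ∷_)) (∈-words (step x s) v v∈ acc)) }) x∈)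

  module _ {r} (_≉_ : Rel A r) where

    data FirstDifference : ∀ {m} → Vec A m → Vec A m → Set (a ⊔ r) where
      here  : ∀ {m x y} {v w : Vec A m} → x ≉ y → FirstDifference (x ∷ v) (y ∷ w)
      there : ∀ {m x} {v w : Vec A m} → FirstDifference v w → FirstDifference (x ∷ v) (x ∷ w)

    words-distinct : AllPairs _≉_ letters → ∀ m s → AllPairs FirstDifference (words m s)
    words-distinct ≉-letters zero s with accepts s
    ... | true  = [] ∷ []
    ... | false = []
    words-distinct ≉-letters (suc m) s =
      AllPairs.concat⁺ (All.map⁺ (All.universal (λ x → AllPairs.map⁺ (AllPairs.map there (words-distinct ≉-letters m (step x s)))) letters))
        (AllPairs.map⁺ (AllPairs.map (λ x≉y → All.map⁺ (All.universal (λ _ → All.map⁺ (All.universal (λ _ → here x≉y) _)) _)) ≉-letters))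

data Class : Set where
  ca cb cc cd ce cf : Class

isFinal : Class → Bool
isFinal cf = true
isFinal _  = false

module Transfer {a ℓ} (R : RawSemiring a ℓ) (q p : RawSemiring.Carrier R) where
  open RawSemiring R using (Carrier; _+_; _*_)

  -- Entry (c, c′) counts the letters (β, γ) ∈ K² taking a state of class c to one of class c′;
  -- here q = |K| and p = q - 1 (see `successors-transfer`).
  transfer : (Class → Carrier) → Class → Carrier
  transfer H ca = q * (q * H ce)
  transfer H cb = q * H cc + p * (q * H ce)
  transfer H cc = q * (q * H cf)
  transfer H cd = (H ca + p * H cc) + p * (q * H cf)
  transfer H ce = q * (H cd + p * H cf)
  transfer H cf = (H cb + p * H ce) + p * (H cd + p * H cf)

  transfer-cong : ∀ {H H′} → (∀ c → H c ≡ H′ c) → ∀ c → transfer H c ≡ transfer H′ c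
  transfer-cong e ca = ≡.cong (λ x → q * (q * x)) (e ce)
  transfer-cong e cb = ≡.cong₂ (λ x y → q * x + p * (q * y)) (e cc) (e ce)
  transfer-cong e cc = ≡.cong (λ x → q * (q * x)) (e cf)
  transfer-cong e cd = ≡.cong₂ (λ x y → x + p * (q * y)) (≡.cong₂ (λ x y → x + p * y) (e ca) (e cc)) (e cf)
  transfer-cong e ce = ≡.cong₂ (λ x y → q * (x + p * y)) (e cd) (e cf)
  transfer-cong e cf = ≡.cong₂ _+_ (≡.cong₂ (λ x y → x + p * y) (e cb) (e ce))
                                   (≡.cong₂ (λ x y → p * (x + p * y)) (e cd) (e cf))

module _ {a b ℓ ℓ′} (R : RawSemiring a ℓ) (R′ : RawSemiring b ℓ′)
         {q p : RawSemiring.Carrier R} {q′ p′ : RawSemiring.Carrier R′} where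
  open RawSemiring R
  open RawSemiring R′ renaming (Carrier to Carrier′; _+_ to _+′_; _*_ to _*′_) using ()
  open Transfer R q p
  open Transfer R′ q′ p′ renaming (transfer to transfer′) using ()

  transfer-homomorphic : (f : Carrier → Carrier′) → (∀ x y → f (x + y) ≡ f x +′ f y) →
                         (∀ x → f (q * x) ≡ q′ *′ f x) → (∀ x → f (p * x) ≡ p′ *′ f x) →
                         ∀ H c → f (transfer H c) ≡ transfer′ (f ∘ H) c
  transfer-homomorphic f f-+ f-q f-p H ca = ≡.trans (f-q _) (≡.cong (q′ *′_) (f-q _))
  transfer-homomorphic f f-+ f-q f-p H cb =
    ≡.trans (f-+ _ _) (≡.cong₂ _+′_ (f-q _) (≡.trans (f-p _) (≡.cong (p′ *′_) (f-q _))))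
  transfer-homomorphic f f-+ f-q f-p H cc = ≡.trans (f-q _) (≡.cong (q′ *′_) (f-q _))
  transfer-homomorphic f f-+ f-q f-p H cd =
    ≡.trans (f-+ _ _) (≡.cong₂ _+′_ (≡.trans (f-+ _ _) (≡.cong (f (H ca) +′_) (f-p _)))
                                    (≡.trans (f-p _) (≡.cong (p′ *′_) (f-q _))))
  transfer-homomorphic f f-+ f-q f-p H ce =
    ≡.trans (f-q _) (≡.cong (q′ *′_) (≡.trans (f-+ _ _) (≡.cong (f (H cd) +′_) (f-p _))))
  transfer-homomorphic f f-+ f-q f-p H cf =
    ≡.trans (f-+ _ _) (≡.cong₂ _+′_ (≡.trans (f-+ _ _) (≡.cong (f (H cb) +′_) (f-p _)))
      (≡.trans (f-p _) (≡.cong (p′ *′_) (≡.trans (f-+ _ _) (≡.cong (f (H cd) +′_) (f-p _))))))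

data Residue₃ : Set where
  r₀ r₁ r₂ : Residue₃

next : Residue₃ → Residue₃
next r₀ = r₁
next r₁ = r₂
next r₂ = r₀

residue : ℕ → Residue₃
residue zero    = r₀
residue (suc n) = next (residue n)

value : Residue₃ → ℕ
value r₀ = 0
value r₁ = 1
value r₂ = 2

%3≡residue : ∀ n → n % 3 ≡ value (residue n)
%3≡residue 0 = ≡.refl
%3≡residue 1 = ≡.refl
%3≡residue 2 = ≡.refl
%3≡residue (suc (suc (suc n))) = begin
  (3 ℕ.+ n) % 3            ≡⟨ ≡.cong (_% 3) (ℕ.+-comm 3 n) ⟩
  (n ℕ.+ 3) % 3            ≡⟨ [m+n]%n≡m%n n 3 ⟩
  n % 3                    ≡⟨ %3≡residue n ⟩
  value (residue n)          ≡⟨ ≡.cong value (next³ (residue n)) ⟨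
  value (residue (3 ℕ.+ n))  ∎
  where
  open ≡.≡-Reasoning
  next³ : ∀ r → next (next (next r)) ≡ r
  next³ r₀ = ≡.refl
  next³ r₁ = ≡.refl
  next³ r₂ = ≡.refl

-- With Y = qⁿ and r = n mod 3, closedForm r c Y is pairCount · classCount (n - 2) c; its three
-- terms come from the eigenvalues q², q ζ (ζ³ = 1) and 1 of the transfer matrix.
module ClosedForm {a ℓ} (R : RawRing a ℓ) (Q : RawRing.Carrier R) where
  open RawRing R using (Carrier; _+_; _*_; -_; 0#; 1#)

  private
    infixl 6 _-_
    _-_ : Carrier → Carrier → Carrier
    x - y = x + - y

  linear : Residue₃ → Class → Carrier
  linear r₀ ca = Q - Q * (Q * Q)
  linear r₁ ca = Q * (Q * Q) - Q
  linear r₂ ca = 0#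
  linear r₀ cb = - (1# + Q * (Q * Q))
  linear r₁ cb = ((1# + Q) + Q * Q) + Q * (Q * Q)
  linear r₂ cb = - (Q + Q * Q)
  linear r₀ cc = (Q + Q * Q) + (Q + Q * Q)
  linear r₁ cc = - (Q + Q * Q)
  linear r₂ cc = - (Q + Q * Q)
  linear r₀ cd = Q * Q - 1#
  linear r₁ cd = 0#
  linear r₂ cd = 1# - Q * Q
  linear r₀ ce = Q * Q - 1#
  linear r₁ ce = 0#
  linear r₂ ce = 1# - Q * Q
  linear r₀ cf = - (1# + Q)
  linear r₁ cf = - (1# + Q)
  linear r₂ cf = (1# + Q) + (1# + Q)

  constant : Class → Carrier
  constant ca = - (Q * (Q * (Q * Q)))
  constant cb = Q * (Q * Q)
  constant cc = Q * (Q * Q)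
  constant cd = - (Q * Q)
  constant ce = - (Q * Q)
  constant cf = Q

  closedForm : Residue₃ → Class → Carrier → Carrier
  closedForm r c Y = (Y * Y + linear r c * Y) + constant c

module _ where
  open ℤ-Solver.+-*-Solver using (Polynomial; _:+_; _:*_; :-_; _:-_; con; solve; _:=_)

  private
    polynomials : ℕ → RawRing _ _
    polynomials n = record
      { Carrier = Polynomial n ; _≈_ = _≡_ ; _+_ = _:+_ ; _*_ = _:*_ ; -_ = :-_
      ; 0# = con (+ 0) ; 1# = con (+ 1) }

    transferᴾ : Polynomial 2 → (Class → Polynomial 2) → Class → Polynomial 2
    transferᴾ Q = Transfer.transfer (RawRing.rawSemiring (polynomials 2)) Q (Q :- con (+ 1))

    closedFormᴾ : ∀ {n} → Polynomial n → Residue₃ → Class → Polynomial n → Polynomial n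
    closedFormᴾ {n} = ClosedForm.closedForm (polynomials n)

    stepEquation : Residue₃ → Class → Polynomial 2 → Polynomial 2 → Polynomial 2 × Polynomial 2
    stepEquation r c Q Y = transferᴾ Q (λ c′ → closedFormᴾ Q r c′ Y) c := closedFormᴾ Q (next r) c (Q :* Y)

  transferℤ : ℤ → (Class → ℤ) → Class → ℤ
  transferℤ Q = Transfer.transfer ℤ.+-*-rawSemiring Q (Q ℤ.- + 1)

  closedFormℤ : ℤ → Residue₃ → Class → ℤ → ℤ
  closedFormℤ = ClosedForm.closedForm ℤ.+-*-rawRing

  transfer-closedForm : ∀ r c Q Y → transferℤ Q (λ c′ → closedFormℤ Q r c′ Y) c ≡ closedFormℤ Q (next r) c (Q ℤ.* Y)
  transfer-closedForm r₀ ca = solve 2 (stepEquation r₀ ca) ≡.refl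
  transfer-closedForm r₀ cb = solve 2 (stepEquation r₀ cb) ≡.refl
  transfer-closedForm r₀ cc = solve 2 (stepEquation r₀ cc) ≡.refl
  transfer-closedForm r₀ cd = solve 2 (stepEquation r₀ cd) ≡.refl
  transfer-closedForm r₀ ce = solve 2 (stepEquation r₀ ce) ≡.refl
  transfer-closedForm r₀ cf = solve 2 (stepEquation r₀ cf) ≡.refl
  transfer-closedForm r₁ ca = solve 2 (stepEquation r₁ ca) ≡.refl
  transfer-closedForm r₁ cb = solve 2 (stepEquation r₁ cb) ≡.refl
  transfer-closedForm r₁ cc = solve 2 (stepEquation r₁ cc) ≡.refl
  transfer-closedForm r₁ cd = solve 2 (stepEquation r₁ cd) ≡.refl
  transfer-closedForm r₁ ce = solve 2 (stepEquation r₁ ce) ≡.refl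
  transfer-closedForm r₁ cf = solve 2 (stepEquation r₁ cf) ≡.refl
  transfer-closedForm r₂ ca = solve 2 (stepEquation r₂ ca) ≡.refl
  transfer-closedForm r₂ cb = solve 2 (stepEquation r₂ cb) ≡.refl
  transfer-closedForm r₂ cc = solve 2 (stepEquation r₂ cc) ≡.refl
  transfer-closedForm r₂ cd = solve 2 (stepEquation r₂ cd) ≡.refl
  transfer-closedForm r₂ ce = solve 2 (stepEquation r₂ ce) ≡.refl
  transfer-closedForm r₂ cf = solve 2 (stepEquation r₂ cf) ≡.refl

  module ClassCounts (p : ℕ) where
    open ≡.≡-Reasoning

    q : ℕ
    q = suc p

    open Transfer ℕ.+-*-rawSemiring q p public using (transfer)

    classCount : ℕ → Class → ℕ
    classCount zero    c = if isFinal c then 1 else 0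
    classCount (suc m)   = transfer (classCount m)

    pointCount : ℕ
    pointCount = suc (q ℕ.* q ℕ.+ q)

    pairCount : ℕ
    pairCount = pointCount ℕ.* ℕ.pred pointCount

    private
      Q : ℤ
      Q = + q

      pairCount≡ : + pairCount ≡ (+ 1 ℤ.+ (Q ℤ.* Q ℤ.+ Q)) ℤ.* (Q ℤ.* Q ℤ.+ Q)
      pairCount≡ = begin
        + (pointCount ℕ.* (q ℕ.* q ℕ.+ q))                    ≡⟨ ℤ.pos-* pointCount (q ℕ.* q ℕ.+ q) ⟩
        + pointCount ℤ.* + (q ℕ.* q ℕ.+ q)                    ≡⟨ ≡.cong (ℤ._* + (q ℕ.* q ℕ.+ q)) (ℤ.pos-+ 1 (q ℕ.* q ℕ.+ q)) ⟩
        (+ 1 ℤ.+ + (q ℕ.* q ℕ.+ q)) ℤ.* + (q ℕ.* q ℕ.+ q)      ≡⟨ ≡.cong (λ x → (+ 1 ℤ.+ x) ℤ.* x) q²+q ⟩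
        (+ 1 ℤ.+ (Q ℤ.* Q ℤ.+ Q)) ℤ.* (Q ℤ.* Q ℤ.+ Q)         ∎
        where
        q²+q : + (q ℕ.* q ℕ.+ q) ≡ Q ℤ.* Q ℤ.+ Q
        q²+q = ≡.trans (ℤ.pos-+ (q ℕ.* q) q) (≡.cong (ℤ._+ Q) (ℤ.pos-* q q))

      baseEquation : Class → Polynomial 1 → Polynomial 1 × Polynomial 1
      baseEquation c Q = closedFormᴾ Q r₂ c (Q :* (Q :* con (+ 1)))
                      := (if isFinal c then (con (+ 1) :+ (Q :* Q :+ Q)) :* (Q :* Q :+ Q) else con (+ 0))

      closedForm-base : ∀ c → closedFormℤ Q r₂ c (Q ℤ.^ 2)
                              ≡ (if isFinal c then (+ 1 ℤ.+ (Q ℤ.* Q ℤ.+ Q)) ℤ.* (Q ℤ.* Q ℤ.+ Q) else + 0)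
      closedForm-base ca = solve 1 (baseEquation ca) ≡.refl Q
      closedForm-base cb = solve 1 (baseEquation cb) ≡.refl Q
      closedForm-base cc = solve 1 (baseEquation cc) ≡.refl Q
      closedForm-base cd = solve 1 (baseEquation cd) ≡.refl Q
      closedForm-base ce = solve 1 (baseEquation ce) ≡.refl Q
      closedForm-base cf = solve 1 (baseEquation cf) ≡.refl Q

      scaled : ℕ → ℤ
      scaled x = + (pairCount ℕ.* x)

      scaled-+ : ∀ x y → scaled (x ℕ.+ y) ≡ scaled x ℤ.+ scaled y
      scaled-+ x y = ≡.trans (≡.cong +_ (ℕ.*-distribˡ-+ pairCount x y)) (ℤ.pos-+ (pairCount ℕ.* x) (pairCount ℕ.* y))

      scaled-* : ∀ a x → scaled (a ℕ.* x) ≡ + a ℤ.* scaled x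
      scaled-* a x = ≡.trans (≡.cong +_ (x∙yz≈y∙xz pairCount a x)) (ℤ.pos-* a _)
        where open import Algebra.Properties.CommutativeSemigroup ℕ.*-commutativeSemigroup using (x∙yz≈y∙xz)

    closedForm-classCount : ∀ m c → + (pairCount ℕ.* classCount m c)
                                    ≡ closedFormℤ Q (residue (2 ℕ.+ m)) c (Q ℤ.^ (2 ℕ.+ m))
    closedForm-classCount zero c = ≡.sym (≡.trans (closedForm-base c) (base (isFinal c)))
      where
      base : ∀ b → (if b then (+ 1 ℤ.+ (Q ℤ.* Q ℤ.+ Q)) ℤ.* (Q ℤ.* Q ℤ.+ Q) else + 0)
                   ≡ + (pairCount ℕ.* (if b then 1 else 0))
      base true  = ≡.trans (≡.sym pairCount≡) (≡.cong +_ (≡.sym (ℕ.*-identityʳ pairCount)))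
      base false = ≡.cong +_ (≡.sym (ℕ.*-zeroʳ pairCount))
    closedForm-classCount (suc m) c = begin
      scaled (transfer (classCount m) c)
        ≡⟨ transfer-homomorphic ℕ.+-*-rawSemiring ℤ.+-*-rawSemiring scaled scaled-+ (scaled-* q) (scaled-* p) (classCount m) c ⟩
      transferℤ Q (scaled ∘ classCount m) c
        ≡⟨ Transfer.transfer-cong ℤ.+-*-rawSemiring Q (Q ℤ.- + 1) (closedForm-classCount m) c ⟩
      transferℤ Q (λ c′ → closedFormℤ Q (residue (2 ℕ.+ m)) c′ (Q ℤ.^ (2 ℕ.+ m))) c
        ≡⟨ transfer-closedForm (residue (2 ℕ.+ m)) c Q (Q ℤ.^ (2 ℕ.+ m)) ⟩
      closedFormℤ Q (residue (3 ℕ.+ m)) c (Q ℤ.^ (3 ℕ.+ m)) ∎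

    private
      Q^2n : ∀ n → Q ℤ.^ (2 ℕ.* n) ≡ Q ℤ.^ n ℤ.* Q ℤ.^ n
      Q^2n n = ≡.trans (ℤ.^-distribˡ-+-* Q n (n ℕ.+ 0)) (≡.cong (λ k → Q ℤ.^ n ℤ.* Q ℤ.^ k) (ℕ.+-identityʳ n))

      Q^[n+k] : ∀ n k → Q ℤ.^ (n ℕ.+ k) ≡ Q ℤ.^ n ℤ.* Q ℤ.^ k
      Q^[n+k] n k = ℤ.^-distribˡ-+-* Q n k

      polynomial-n≢0 : ∀ Q Y → (Y ℤ.* Y ℤ.+ ℤ.- (Q ℤ.+ Q ℤ.* Q) ℤ.* Y) ℤ.+ Q ℤ.* (Q ℤ.* Q)
                              ≡ ((Y ℤ.* Y ℤ.- Y ℤ.* (Q ℤ.* (Q ℤ.* + 1))) ℤ.- Y ℤ.* (Q ℤ.* + 1)) ℤ.+ Q ℤ.* (Q ℤ.* (Q ℤ.* + 1))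
      polynomial-n≢0 = solve-∀

      polynomial-n≡0 : ∀ Q Y → (Y ℤ.* Y ℤ.+ ((Q ℤ.+ Q ℤ.* Q) ℤ.+ (Q ℤ.+ Q ℤ.* Q)) ℤ.* Y) ℤ.+ Q ℤ.* (Q ℤ.* Q)
                          ≡ ((Y ℤ.* Y ℤ.+ + 2 ℤ.* (Y ℤ.* (Q ℤ.* (Q ℤ.* + 1)))) ℤ.+ + 2 ℤ.* (Y ℤ.* (Q ℤ.* + 1)))
                            ℤ.+ Q ℤ.* (Q ℤ.* (Q ℤ.* + 1))
      polynomial-n≡0 = solve-∀

      expand-n≢0 : ∀ m {N} → let n = 2 ℕ.+ m; Y = Q ℤ.^ n in
        N ≡ (Y ℤ.* Y ℤ.+ ℤ.- (Q ℤ.+ Q ℤ.* Q) ℤ.* Y) ℤ.+ Q ℤ.* (Q ℤ.* Q) →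
        N ≡ ((Q ℤ.^ (2 ℕ.* n) ℤ.- Q ℤ.^ (n ℕ.+ 2)) ℤ.- Q ℤ.^ (n ℕ.+ 1)) ℤ.+ Q ℤ.^ 3
      expand-n≢0 m {N} count = begin
        N                                                             ≡⟨ count ⟩
        (Y ℤ.* Y ℤ.+ ℤ.- (Q ℤ.+ Q ℤ.* Q) ℤ.* Y) ℤ.+ Q ℤ.* (Q ℤ.* Q)   ≡⟨ polynomial-n≢0 Q Y ⟩
        ((Y ℤ.* Y ℤ.- Y ℤ.* Q ℤ.^ 2) ℤ.- Y ℤ.* Q ℤ.^ 1) ℤ.+ Q ℤ.^ 3
          ≡⟨ ≡.cong₂ (λ a b → (a ℤ.- b) ℤ.+ Q ℤ.^ 3)
                     (≡.cong₂ ℤ._-_ (≡.sym (Q^2n n)) (≡.sym (Q^[n+k] n 2))) (≡.sym (Q^[n+k] n 1)) ⟩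
        ((Q ℤ.^ (2 ℕ.* n) ℤ.- Q ℤ.^ (n ℕ.+ 2)) ℤ.- Q ℤ.^ (n ℕ.+ 1)) ℤ.+ Q ℤ.^ 3 ∎
        where n = 2 ℕ.+ m; Y = Q ℤ.^ n

      expand-n≡0 : ∀ m {N} → let n = 2 ℕ.+ m; Y = Q ℤ.^ n in
        N ≡ (Y ℤ.* Y ℤ.+ ((Q ℤ.+ Q ℤ.* Q) ℤ.+ (Q ℤ.+ Q ℤ.* Q)) ℤ.* Y) ℤ.+ Q ℤ.* (Q ℤ.* Q) →
        N ≡ ((Q ℤ.^ (2 ℕ.* n) ℤ.+ + 2 ℤ.* Q ℤ.^ (n ℕ.+ 2)) ℤ.+ + 2 ℤ.* Q ℤ.^ (n ℕ.+ 1)) ℤ.+ Q ℤ.^ 3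
      expand-n≡0 m {N} count = begin
        N                                                                               ≡⟨ count ⟩
        (Y ℤ.* Y ℤ.+ ((Q ℤ.+ Q ℤ.* Q) ℤ.+ (Q ℤ.+ Q ℤ.* Q)) ℤ.* Y) ℤ.+ Q ℤ.* (Q ℤ.* Q)   ≡⟨ polynomial-n≡0 Q Y ⟩
        ((Y ℤ.* Y ℤ.+ + 2 ℤ.* (Y ℤ.* Q ℤ.^ 2)) ℤ.+ + 2 ℤ.* (Y ℤ.* Q ℤ.^ 1)) ℤ.+ Q ℤ.^ 3
          ≡⟨ ≡.cong₂ (λ a b → (a ℤ.+ + 2 ℤ.* b) ℤ.+ Q ℤ.^ 3)
                     (≡.cong₂ (λ a b → a ℤ.+ + 2 ℤ.* b) (≡.sym (Q^2n n)) (≡.sym (Q^[n+k] n 2))) (≡.sym (Q^[n+k] n 1)) ⟩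
        ((Q ℤ.^ (2 ℕ.* n) ℤ.+ + 2 ℤ.* Q ℤ.^ (n ℕ.+ 2)) ℤ.+ + 2 ℤ.* Q ℤ.^ (n ℕ.+ 1)) ℤ.+ Q ℤ.^ 3 ∎
        where n = 2 ℕ.+ m; Y = Q ℤ.^ n

    pairCount*classCount-cc : ∀ m → let n = 2 ℕ.+ m in
      (¬ (n % 3 ≡ 0) → + (pairCount ℕ.* classCount m cc)
                         ≡ ((Q ℤ.^ (2 ℕ.* n) ℤ.- Q ℤ.^ (n ℕ.+ 2)) ℤ.- Q ℤ.^ (n ℕ.+ 1)) ℤ.+ Q ℤ.^ 3) ×
      (n % 3 ≡ 0 → + (pairCount ℕ.* classCount m cc)
                     ≡ ((Q ℤ.^ (2 ℕ.* n) ℤ.+ + 2 ℤ.* Q ℤ.^ (n ℕ.+ 2)) ℤ.+ + 2 ℤ.* Q ℤ.^ (n ℕ.+ 1)) ℤ.+ Q ℤ.^ 3)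
    pairCount*classCount-cc m with residue (2 ℕ.+ m) | %3≡residue (2 ℕ.+ m) | closedForm-classCount m cc
    ... | r₀ | n%3≡0 | count = (λ n%3≢0 → contradiction n%3≡0 n%3≢0) , λ _ → expand-n≡0 m count
    ... | r₁ | n%3≡1 | count = (λ _ → expand-n≢0 m count) , λ n%3≡0 → contradiction (≡.trans (≡.sym n%3≡1) n%3≡0) λ ()
    ... | r₂ | n%3≡2 | count = (λ _ → expand-n≢0 m count) , λ n%3≡0 → contradiction (≡.trans (≡.sym n%3≡2) n%3≡0) λ ()

module FiniteSetoid {c ℓ} (S : Setoid c ℓ) {N : ℕ}
                    (card : HasCardinality (Setoid._≈_ S) (λ _ → ⊤) N) where
  open Setoid S

  elements : List Carrier
  elements = proj₁ card

  length-elements : length elements ≡ N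
  length-elements = proj₁ (proj₂ card)

  elements-distinct : AllPairs _≉_ elements
  elements-distinct = proj₁ (proj₂ (proj₂ (proj₂ card)))

  ∈-elements : ∀ x → Any (x ≈_) elements
  ∈-elements x = proj₂ (proj₂ (proj₂ (proj₂ card))) x tt

  infix 4 _≟_
  _≟_ : Decidable _≈_
  x ≟ y = decide elements-distinct (∈-elements x) (∈-elements y)
    where
    decide : ∀ {zs} → AllPairs _≉_ zs → Any (x ≈_) zs → Any (y ≈_) zs → Dec (x ≈ y)
    decide _            (here x≈z)  (here y≈z)  = yes (trans x≈z (sym y≈z))
    decide (z≉zs ∷ _)   (here x≈z)  (there y∈)  = no λ x≈y →
      let (z≉w , y≈w) = All.lookupAny z≉zs y∈ in z≉w (trans (trans (sym x≈z) x≈y) y≈w)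
    decide (z≉zs ∷ _)   (there x∈)  (here y≈z)  = no λ x≈y →
      let (z≉w , x≈w) = All.lookupAny z≉zs x∈ in z≉w (trans (trans (sym y≈z) (sym x≈y)) x≈w)
    decide (_ ∷ distinct) (there x∈) (there y∈) = decide distinct x∈ y∈

  representative : Carrier → Carrier
  representative x = proj₁ (find (∈-elements x))

  representative-∈ : ∀ x → representative x ∈ elements
  representative-∈ x = proj₁ (proj₂ (find (∈-elements x)))

  ≈-representative : ∀ x → x ≈ representative x
  ≈-representative x = proj₂ (proj₂ (find (∈-elements x)))

  N≡suc[pred] : Carrier → N ≡ suc (ℕ.pred N)
  N≡suc[pred] x with elements | length-elements | ∈-elements x
  ... | _ ∷ _ | ≡.refl | _ = ≡.refl

  sumOver : (Carrier → ℕ) → ℕ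
  sumOver f = sum (map f elements)

  sumOver-const : ∀ (f : Carrier → ℕ) {k} → (∀ x → f x ≡ k) → sumOver f ≡ N ℕ.* k
  sumOver-const f {k} f≡k = ≡.trans (sum-map-const f (All.universal f≡k elements)) (≡.cong (ℕ._* k) length-elements)

  sumOver-except : ∀ (f : Carrier → ℕ) t {k k′} → (∀ x → x ≈ t → f x ≡ k′) → (∀ x → x ≉ t → f x ≡ k) →
                   sumOver f ≡ k′ ℕ.+ ℕ.pred N ℕ.* k
  sumOver-except f t {k} {k′} at-t elsewhere =
    ≡.trans (go elements-distinct (∈-elements t)) (≡.cong (λ l → k′ ℕ.+ ℕ.pred l ℕ.* k) length-elements)
    where
    go : ∀ {zs} → AllPairs _≉_ zs → Any (t ≈_) zs → sum (map f zs) ≡ k′ ℕ.+ ℕ.pred (length zs) ℕ.* k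
    go {z ∷ zs} (z≉zs ∷ _) (here t≈z) =
      ≡.cong₂ ℕ._+_ (at-t z (sym t≈z))
        (sum-map-const f (All.map (λ {y} z≉y → elsewhere y λ y≈t → z≉y (sym (trans y≈t t≈z))) z≉zs))
    go {z ∷ y ∷ zs} (z≉zs ∷ distinct) (there t∈) =
      ≡.trans (≡.cong₂ ℕ._+_ (elsewhere z z≉t) (go distinct t∈))
              (x∙yz≈y∙xz k k′ (length zs ℕ.* k))
      where
      open import Algebra.Properties.CommutativeSemigroup ℕ.+-commutativeSemigroup using (x∙yz≈y∙xz)
      z≉t : z ≉ t
      z≉t = let (z≉w , t≈w) = All.lookupAny z≉zs t∈ in λ z≈t → z≉w (trans z≈t t≈w)

-- Generic in the ring so that, instantiated at solver polynomials, `det`, `comb`, … evaluate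
-- definitionally to their field counterparts; each identity below is then a single `solve`.
module Vector³ {a ℓ} (R : RawRing a ℓ) where
  open RawRing R

  private
    infixl 6 _-_
    _-_ : Carrier → Carrier → Carrier
    x - y = x + - y

  V³ : Set a
  V³ = Carrier × Carrier × Carrier

  infixr 7 _·_
  _·_ : Carrier → V³ → V³
  t · (x₁ , x₂ , x₃) = t * x₁ , t * x₂ , t * x₃

  infixl 6 _⊕_
  _⊕_ : V³ → V³ → V³
  (x₁ , x₂ , x₃) ⊕ (y₁ , y₂ , y₃) = x₁ + y₁ , x₂ + y₂ , x₃ + y₃

  π₁ π₂ π₃ : V³ → Carrier
  π₁ (x₁ , _ , _) = x₁
  π₂ (_ , x₂ , _) = x₂
  π₃ (_ , _ , x₃) = x₃

  comb : Carrier → Carrier → Carrier → V³ → V³ → V³ → V³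
  comb a b d x y z = a · x ⊕ b · y ⊕ d · z

  cross : V³ → V³ → V³
  cross (x₁ , x₂ , x₃) (y₁ , y₂ , y₃) = x₂ * y₃ - x₃ * y₂ , x₃ * y₁ - x₁ * y₃ , x₁ * y₂ - x₂ * y₁

  det : V³ → V³ → V³ → Carrier
  det (x₁ , x₂ , x₃) (y₁ , y₂ , y₃) (z₁ , z₂ , z₃) =
    (x₁ * (y₂ * z₃ - y₃ * z₂) - x₂ * (y₁ * z₃ - y₃ * z₁)) + x₃ * (y₁ * z₂ - y₂ * z₁)

  e₁ e₂ e₃ : V³
  e₁ = 1# , 0# , 0#
  e₂ = 0# , 1# , 0#
  e₃ = 0# , 0# , 1#

module FieldProperties {c ℓ} (F : Field c ℓ) (_≟_ : Decidable (Field._≈_ F)) where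
  open Field F
  open ℤ-CoefficientSolver commutativeRing′ using (solve; _:=_; _:+_; _:*_; :-_; _:-_; con)
  open import Relation.Binary.Reasoning.Setoid setoid

  -- 0# ⁻¹ = 0#.
  infix 8 _⁻¹
  _⁻¹ : Carrier → Carrier
  x ⁻¹ with x ≟ 0#
  ... | yes _   = 0#
  ... | no x≉0 = proj₁ (inverse x x≉0)

  x*x⁻¹≈1 : ∀ {x} → x ≉ 0# → x * x ⁻¹ ≈ 1#
  x*x⁻¹≈1 {x} x≉0 with x ≟ 0#
  ... | yes x≈0  = ⊥-elim (x≉0 x≈0)
  ... | no x≉0′ = proj₂ (inverse x x≉0′)

  x⁻¹*x≈1 : ∀ {x} → x ≉ 0# → x ⁻¹ * x ≈ 1#
  x⁻¹*x≈1 x≉0 = trans (*-comm _ _) (x*x⁻¹≈1 x≉0)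

  x*y≈0⇒y≈0 : ∀ {x y} → x ≉ 0# → x * y ≈ 0# → y ≈ 0#
  x*y≈0⇒y≈0 {x} {y} x≉0 xy≈0 = begin
    y              ≈⟨ *-identityˡ y ⟨
    1# * y         ≈⟨ *-congʳ (x⁻¹*x≈1 x≉0) ⟨
    (x ⁻¹ * x) * y ≈⟨ *-assoc _ _ _ ⟩
    x ⁻¹ * (x * y) ≈⟨ *-congˡ xy≈0 ⟩
    x ⁻¹ * 0#      ≈⟨ zeroʳ _ ⟩
    0#             ∎

  x≉0∧y≉0⇒x*y≉0 : ∀ {x y} → x ≉ 0# → y ≉ 0# → x * y ≉ 0#
  x≉0∧y≉0⇒x*y≉0 x≉0 y≉0 xy≈0 = y≉0 (x*y≈0⇒y≈0 x≉0 xy≈0)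

  x⁻¹≉0 : ∀ {x} → x ≉ 0# → x ⁻¹ ≉ 0#
  x⁻¹≉0 {x} x≉0 x⁻¹≈0 = 1≉0 (begin
    1#        ≈⟨ x*x⁻¹≈1 x≉0 ⟨
    x * x ⁻¹  ≈⟨ *-congˡ x⁻¹≈0 ⟩
    x * 0#    ≈⟨ zeroʳ x ⟩
    0#        ∎)

  x-y≈0⇒x≈y : ∀ {x y} → x - y ≈ 0# → x ≈ y
  x-y≈0⇒x≈y {x} {y} x-y≈0 = begin
    x           ≈⟨ solve 2 (λ x y → x := (x :- y) :+ y) refl x y ⟩
    (x - y) + y ≈⟨ +-congʳ x-y≈0 ⟩
    0# + y      ≈⟨ +-identityˡ y ⟩
    y           ∎

  x-0*y≈x : ∀ {x a} y → a ≈ 0# → x - a * y ≈ x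
  x-0*y≈x {x} y a≈0 = trans (+-congˡ (-‿cong (trans (*-congʳ a≈0) (zeroˡ y)))) (solve 1 (λ x → x :- con (+ 0) := x) refl x)

  x+y*0≈x : ∀ {x a} y → a ≈ 0# → x + y * a ≈ x
  x+y*0≈x {x} y a≈0 = trans (+-congˡ (trans (*-congˡ a≈0) (zeroʳ y))) (+-identityʳ x)

  ≉-resp-≈ : ∀ {x y} → x ≈ y → y ≉ 0# → x ≉ 0#
  ≉-resp-≈ x≈y y≉0 x≈0 = y≉0 (trans (sym x≈y) x≈0)

  -x≈0⇒x≈0 : ∀ {x} → - x ≈ 0# → x ≈ 0#
  -x≈0⇒x≈0 {x} -x≈0 = begin
    x      ≈⟨ solve 1 (λ x → x := :- (:- x)) refl x ⟩
    - - x  ≈⟨ -‿cong -x≈0 ⟩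
    - 0#   ≈⟨ solve 0 (:- con (+ 0) := con (+ 0)) refl ⟩
    0#     ∎

  x≈c*u⁻¹⇒c-u*x≈0 : ∀ {c u x} → u ≉ 0# → x ≈ c * u ⁻¹ → c - u * x ≈ 0#
  x≈c*u⁻¹⇒c-u*x≈0 {c} {u} {x} u≉0 x≈c/u = begin
    c - u * x          ≈⟨ +-congˡ (-‿cong (*-congˡ x≈c/u)) ⟩
    c - u * (c * u ⁻¹) ≈⟨ solve 3 (λ c u v → c :- u :* (c :* v) := c :- c :* (u :* v)) refl c u (u ⁻¹) ⟩
    c - c * (u * u ⁻¹) ≈⟨ +-congˡ (-‿cong (*-congˡ (x*x⁻¹≈1 u≉0))) ⟩
    c - c * 1#         ≈⟨ solve 1 (λ c → c :- c :* con (+ 1) := con (+ 0)) refl c ⟩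
    0#                 ∎

  c-u*x≈0⇒x≈c*u⁻¹ : ∀ {c u x} → u ≉ 0# → c - u * x ≈ 0# → x ≈ c * u ⁻¹
  c-u*x≈0⇒x≈c*u⁻¹ {c} {u} {x} u≉0 c-ux≈0 = begin
    x                                  ≈⟨ solve 1 (λ x → x := x :* con (+ 1)) refl x ⟩
    x * 1#                             ≈⟨ *-congˡ (x*x⁻¹≈1 u≉0) ⟨
    x * (u * u ⁻¹)                     ≈⟨ solve 4 (λ c u x v → x :* (u :* v) := c :* v :- (c :- u :* x) :* v) refl c u x (u ⁻¹) ⟩
    c * u ⁻¹ - (c - u * x) * u ⁻¹      ≈⟨ +-congˡ (-‿cong (trans (*-congʳ c-ux≈0) (zeroˡ _))) ⟩
    c * u ⁻¹ - 0#                      ≈⟨ solve 1 (λ y → y :- con (+ 0) := y) refl (c * u ⁻¹) ⟩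
    c * u ⁻¹                           ∎

  x≈-c*u⁻¹⇒c+x*u≈0 : ∀ {c u x} → u ≉ 0# → x ≈ - c * u ⁻¹ → c + x * u ≈ 0#
  x≈-c*u⁻¹⇒c+x*u≈0 {c} {u} {x} u≉0 x≈-c/u = begin
    c + x * u            ≈⟨ +-congˡ (*-congʳ x≈-c/u) ⟩
    c + (- c * u ⁻¹) * u ≈⟨ solve 3 (λ c u v → c :+ (:- c :* v) :* u := c :- c :* (u :* v)) refl c u (u ⁻¹) ⟩
    c - c * (u * u ⁻¹)   ≈⟨ +-congˡ (-‿cong (*-congˡ (x*x⁻¹≈1 u≉0))) ⟩
    c - c * 1#           ≈⟨ solve 1 (λ c → c :- c :* con (+ 1) := con (+ 0)) refl c ⟩
    0#                   ∎

  c+x*u≈0⇒x≈-c*u⁻¹ : ∀ {c u x} → u ≉ 0# → c + x * u ≈ 0# → x ≈ - c * u ⁻¹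
  c+x*u≈0⇒x≈-c*u⁻¹ {c} {u} {x} u≉0 c+xu≈0 = begin
    x                                  ≈⟨ solve 1 (λ x → x := x :* con (+ 1)) refl x ⟩
    x * 1#                             ≈⟨ *-congˡ (x*x⁻¹≈1 u≉0) ⟨
    x * (u * u ⁻¹)                     ≈⟨ solve 4 (λ c u x v → x :* (u :* v) := (c :+ x :* u) :* v :+ :- c :* v) refl c u x (u ⁻¹) ⟩
    (c + x * u) * u ⁻¹ + - c * u ⁻¹    ≈⟨ +-congʳ (trans (*-congʳ c+xu≈0) (zeroˡ _)) ⟩
    0# + - c * u ⁻¹                    ≈⟨ +-identityˡ _ ⟩
    - c * u ⁻¹                         ∎

module Determinant {c ℓ} (F : Field c ℓ) (_≟_ : Decidable (Field._≈_ F)) where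
  open Field F
  open import Relation.Binary.Reasoning.Setoid setoid
  open FieldProperties F _≟_
  open ℤ-CoefficientSolver commutativeRing′ using (Polynomial; solve; _:=_; _:+_; _:*_; :-_; _:-_; con)
  open Vector³ rawRing public using (V³; π₁; π₂; π₃; _·_; _⊕_; comb; cross; det; e₁; e₂; e₃)

  private
    polynomials : ℕ → RawRing Level.zero Level.zero
    polynomials n = record { Carrier = Polynomial n ; _≈_ = _≡_ ; _+_ = _:+_ ; _*_ = _:*_ ; -_ = :-_
                           ; 0# = con (+ 0) ; 1# = con (+ 1) }
    module ᴾ {n} = Vector³ (polynomials n)

  infix 4 _≈ⱽ_
  _≈ⱽ_ : V³ → V³ → Set ℓ
  _≈ⱽ_ = _≈³_ F

  module ≈ⱽ = Setoid (×-setoid setoid (×-setoid setoid setoid))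

  ·-cong : ∀ {s t u w} → s ≈ t → u ≈ⱽ w → s · u ≈ⱽ t · w
  ·-cong s≈t (u₁≈w₁ , u₂≈w₂ , u₃≈w₃) = *-cong s≈t u₁≈w₁ , *-cong s≈t u₂≈w₂ , *-cong s≈t u₃≈w₃

  det-cong : ∀ {x x′ y y′ z z′} → x ≈ⱽ x′ → y ≈ⱽ y′ → z ≈ⱽ z′ → det x y z ≈ det x′ y′ z′
  det-cong (x₁ , x₂ , x₃) (y₁ , y₂ , y₃) (z₁ , z₂ , z₃) =
    +-cong (+-cong (*-cong x₁ (+-cong (*-cong y₂ z₃) (-‿cong (*-cong y₃ z₂))))
                   (-‿cong (*-cong x₂ (+-cong (*-cong y₁ z₃) (-‿cong (*-cong y₃ z₁))))))
           (*-cong x₃ (+-cong (*-cong y₁ z₂) (-‿cong (*-cong y₂ z₁))))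

  det-cyclic : ∀ x y z → det x y z ≈ det y z x
  det-cyclic (x₁ , x₂ , x₃) (y₁ , y₂ , y₃) (z₁ , z₂ , z₃) =
    solve 9 (λ x₁ x₂ x₃ y₁ y₂ y₃ z₁ z₂ z₃ → let x = x₁ , x₂ , x₃; y = y₁ , y₂ , y₃; z = z₁ , z₂ , z₃ in
               ᴾ.det x y z := ᴾ.det y z x) refl x₁ x₂ x₃ y₁ y₂ y₃ z₁ z₂ z₃

  det-*ˡ : ∀ t x y z → det (t · x) y z ≈ t * det x y z
  det-*ˡ t (x₁ , x₂ , x₃) (y₁ , y₂ , y₃) (z₁ , z₂ , z₃) =
    solve 10 (λ t x₁ x₂ x₃ y₁ y₂ y₃ z₁ z₂ z₃ → let x = x₁ , x₂ , x₃; y = y₁ , y₂ , y₃; z = z₁ , z₂ , z₃ in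
                ᴾ.det (t ᴾ.· x) y z := t :* ᴾ.det x y z) refl t x₁ x₂ x₃ y₁ y₂ y₃ z₁ z₂ z₃

  det-combˡ : ∀ a b d x y z → det (comb a b d x y z) y z ≈ a * det x y z
  det-combˡ a b d (x₁ , x₂ , x₃) (y₁ , y₂ , y₃) (z₁ , z₂ , z₃) =
    solve 12 (λ a b d x₁ x₂ x₃ y₁ y₂ y₃ z₁ z₂ z₃ → let x = x₁ , x₂ , x₃; y = y₁ , y₂ , y₃; z = z₁ , z₂ , z₃ in
                ᴾ.det (ᴾ.comb a b d x y z) y z := a :* ᴾ.det x y z) refl a b d x₁ x₂ x₃ y₁ y₂ y₃ z₁ z₂ z₃

  det-combᵐ : ∀ a b d x y z → det x (comb a b d x y z) z ≈ b * det x y z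
  det-combᵐ a b d (x₁ , x₂ , x₃) (y₁ , y₂ , y₃) (z₁ , z₂ , z₃) =
    solve 12 (λ a b d x₁ x₂ x₃ y₁ y₂ y₃ z₁ z₂ z₃ → let x = x₁ , x₂ , x₃; y = y₁ , y₂ , y₃; z = z₁ , z₂ , z₃ in
                ᴾ.det x (ᴾ.comb a b d x y z) z := b :* ᴾ.det x y z) refl a b d x₁ x₂ x₃ y₁ y₂ y₃ z₁ z₂ z₃

  det-combʳ : ∀ a b d x y z → det x y (comb a b d x y z) ≈ d * det x y z
  det-combʳ a b d (x₁ , x₂ , x₃) (y₁ , y₂ , y₃) (z₁ , z₂ , z₃) =
    solve 12 (λ a b d x₁ x₂ x₃ y₁ y₂ y₃ z₁ z₂ z₃ → let x = x₁ , x₂ , x₃; y = y₁ , y₂ , y₃; z = z₁ , z₂ , z₃ in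
                ᴾ.det x y (ᴾ.comb a b d x y z) := d :* ᴾ.det x y z) refl a b d x₁ x₂ x₃ y₁ y₂ y₃ z₁ z₂ z₃

  det-linearʳ : ∀ a b d x y u v w → det x y (comb a b d u v w) ≈ (a * det x y u + b * det x y v) + d * det x y w
  det-linearʳ a b d (x₁ , x₂ , x₃) (y₁ , y₂ , y₃) (u₁ , u₂ , u₃) (v₁ , v₂ , v₃) (w₁ , w₂ , w₃) =
    solve 18 (λ a b d x₁ x₂ x₃ y₁ y₂ y₃ u₁ u₂ u₃ v₁ v₂ v₃ w₁ w₂ w₃ →
                let x = x₁ , x₂ , x₃; y = y₁ , y₂ , y₃; u = u₁ , u₂ , u₃; v = v₁ , v₂ , v₃; w = w₁ , w₂ , w₃ in
                ᴾ.det x y (ᴾ.comb a b d u v w) := (a :* ᴾ.det x y u :+ b :* ᴾ.det x y v) :+ d :* ᴾ.det x y w)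
             refl a b d x₁ x₂ x₃ y₁ y₂ y₃ u₁ u₂ u₃ v₁ v₂ v₃ w₁ w₂ w₃

  det-repeat₁₃ : ∀ x y → det x y x ≈ 0#
  det-repeat₁₃ (x₁ , x₂ , x₃) (y₁ , y₂ , y₃) =
    solve 6 (λ x₁ x₂ x₃ y₁ y₂ y₃ → let x = x₁ , x₂ , x₃; y = y₁ , y₂ , y₃ in
               ᴾ.det x y x := con (+ 0)) refl x₁ x₂ x₃ y₁ y₂ y₃

  det-repeat₂₃ : ∀ x y → det x y y ≈ 0#
  det-repeat₂₃ (x₁ , x₂ , x₃) (y₁ , y₂ , y₃) =
    solve 6 (λ x₁ x₂ x₃ y₁ y₂ y₃ → let x = x₁ , x₂ , x₃; y = y₁ , y₂ , y₃ in
               ᴾ.det x y y := con (+ 0)) refl x₁ x₂ x₃ y₁ y₂ y₃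

  det-0ˡ : ∀ y z → det (0³ F) y z ≈ 0#
  det-0ˡ (y₁ , y₂ , y₃) (z₁ , z₂ , z₃) =
    solve 6 (λ y₁ y₂ y₃ z₁ z₂ z₃ → let y = y₁ , y₂ , y₃; z = z₁ , z₂ , z₃ in
               ᴾ.det (con (+ 0) , con (+ 0) , con (+ 0)) y z := con (+ 0)) refl y₁ y₂ y₃ z₁ z₂ z₃

  cramer : ∀ x y z w → det x y z · w ≈ⱽ comb (det w y z) (det x w z) (det x y w) x y z
  cramer (x₁ , x₂ , x₃) (y₁ , y₂ , y₃) (z₁ , z₂ , z₃) (w₁ , w₂ , w₃) =
      solve 12 (λ x₁ x₂ x₃ y₁ y₂ y₃ z₁ z₂ z₃ w₁ w₂ w₃ → let x = x₁ , x₂ , x₃; y = y₁ , y₂ , y₃; z = z₁ , z₂ , z₃; w = w₁ , w₂ , w₃ in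
                  ᴾ.π₁ (ᴾ.det x y z ᴾ.· w) := ᴾ.π₁ (ᴾ.comb (ᴾ.det w y z) (ᴾ.det x w z) (ᴾ.det x y w) x y z))
               refl x₁ x₂ x₃ y₁ y₂ y₃ z₁ z₂ z₃ w₁ w₂ w₃
    , solve 12 (λ x₁ x₂ x₃ y₁ y₂ y₃ z₁ z₂ z₃ w₁ w₂ w₃ → let x = x₁ , x₂ , x₃; y = y₁ , y₂ , y₃; z = z₁ , z₂ , z₃; w = w₁ , w₂ , w₃ in
                  ᴾ.π₂ (ᴾ.det x y z ᴾ.· w) := ᴾ.π₂ (ᴾ.comb (ᴾ.det w y z) (ᴾ.det x w z) (ᴾ.det x y w) x y z))
               refl x₁ x₂ x₃ y₁ y₂ y₃ z₁ z₂ z₃ w₁ w₂ w₃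
    , solve 12 (λ x₁ x₂ x₃ y₁ y₂ y₃ z₁ z₂ z₃ w₁ w₂ w₃ → let x = x₁ , x₂ , x₃; y = y₁ , y₂ , y₃; z = z₁ , z₂ , z₃; w = w₁ , w₂ , w₃ in
                  ᴾ.π₃ (ᴾ.det x y z ᴾ.· w) := ᴾ.π₃ (ᴾ.comb (ᴾ.det w y z) (ᴾ.det x w z) (ᴾ.det x y w) x y z))
               refl x₁ x₂ x₃ y₁ y₂ y₃ z₁ z₂ z₃ w₁ w₂ w₃

  data Axis : Set where
    axis₁ axis₂ axis₃ : Axis

  coord : Axis → V³ → Carrier
  coord axis₁ = π₁
  coord axis₂ = π₂
  coord axis₃ = π₃

  basis : Axis → V³
  basis axis₁ = e₁
  basis axis₂ = e₂
  basis axis₃ = e₃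

  det-basis : ∀ k x y → det x y (basis k) ≈ coord k (cross x y)
  det-basis axis₁ (x₁ , x₂ , x₃) (y₁ , y₂ , y₃) =
    solve 6 (λ x₁ x₂ x₃ y₁ y₂ y₃ → let x = x₁ , x₂ , x₃; y = y₁ , y₂ , y₃ in
               ᴾ.det x y ᴾ.e₁ := ᴾ.π₁ (ᴾ.cross x y)) refl x₁ x₂ x₃ y₁ y₂ y₃
  det-basis axis₂ (x₁ , x₂ , x₃) (y₁ , y₂ , y₃) =
    solve 6 (λ x₁ x₂ x₃ y₁ y₂ y₃ → let x = x₁ , x₂ , x₃; y = y₁ , y₂ , y₃ in
               ᴾ.det x y ᴾ.e₂ := ᴾ.π₂ (ᴾ.cross x y)) refl x₁ x₂ x₃ y₁ y₂ y₃
  det-basis axis₃ (x₁ , x₂ , x₃) (y₁ , y₂ , y₃) =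
    solve 6 (λ x₁ x₂ x₃ y₁ y₂ y₃ → let x = x₁ , x₂ , x₃; y = y₁ , y₂ , y₃ in
               ᴾ.det x y ᴾ.e₃ := ᴾ.π₃ (ᴾ.cross x y)) refl x₁ x₂ x₃ y₁ y₂ y₃

  cross≈0⇒minors≈0 : ∀ {x y} → cross x y ≈ⱽ 0³ F → ∀ k j → coord k y * coord j x ≈ coord k x * coord j y
  cross≈0⇒minors≈0 {x} {y} (c₁≈0 , c₂≈0 , c₃≈0) = minors
    where
    x₂y₃≈x₃y₂ : π₂ x * π₃ y ≈ π₃ x * π₂ y
    x₂y₃≈x₃y₂ = x-y≈0⇒x≈y c₁≈0
    x₃y₁≈x₁y₃ : π₃ x * π₁ y ≈ π₁ x * π₃ y
    x₃y₁≈x₁y₃ = x-y≈0⇒x≈y c₂≈0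
    x₁y₂≈x₂y₁ : π₁ x * π₂ y ≈ π₂ x * π₁ y
    x₁y₂≈x₂y₁ = x-y≈0⇒x≈y c₃≈0
    minors : ∀ k j → coord k y * coord j x ≈ coord k x * coord j y
    minors axis₁ axis₁ = *-comm _ _
    minors axis₁ axis₂ = trans (*-comm _ _) (sym x₁y₂≈x₂y₁)
    minors axis₁ axis₃ = trans (*-comm _ _) x₃y₁≈x₁y₃
    minors axis₂ axis₁ = trans (*-comm _ _) x₁y₂≈x₂y₁
    minors axis₂ axis₂ = *-comm _ _
    minors axis₂ axis₃ = trans (*-comm _ _) (sym x₂y₃≈x₃y₂)
    minors axis₃ axis₁ = trans (*-comm _ _) (sym x₃y₁≈x₁y₃)
    minors axis₃ axis₂ = trans (*-comm _ _) x₂y₃≈x₃y₂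
    minors axis₃ axis₃ = *-comm _ _

  pick : V³ → Axis
  pick (x₁ , x₂ , x₃) with x₁ ≟ 0# | x₂ ≟ 0#
  ... | no _  | _     = axis₁
  ... | yes _ | no _  = axis₂
  ... | yes _ | yes _ = axis₃

  coord-pick≉0 : ∀ {x} → ¬ (x ≈ⱽ 0³ F) → coord (pick x) x ≉ 0#
  coord-pick≉0 {x₁ , x₂ , x₃} x≉0 with x₁ ≟ 0# | x₂ ≟ 0#
  ... | no x₁≉0  | _        = x₁≉0
  ... | yes _    | no x₂≉0  = x₂≉0
  ... | yes x₁≈0 | yes x₂≈0 = λ x₃≈0 → x≉0 (x₁≈0 , x₂≈0 , x₃≈0)

  proportional : ∀ {x y} k → coord k x ≉ 0# → (∀ j → coord k y * coord j x ≈ coord k x * coord j y) →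
                 (coord k y * coord k x ⁻¹) · x ≈ⱽ y
  proportional {x} {y} k xₖ≉0 minors = component axis₁ , component axis₂ , component axis₃
    where
    component : ∀ j → (coord k y * coord k x ⁻¹) * coord j x ≈ coord j y
    component j = begin
      (coord k y * coord k x ⁻¹) * coord j x ≈⟨ solve 3 (λ a w b → (a :* w) :* b := w :* (a :* b)) refl _ _ _ ⟩
      coord k x ⁻¹ * (coord k y * coord j x) ≈⟨ *-congˡ (minors j) ⟩
      coord k x ⁻¹ * (coord k x * coord j y) ≈⟨ *-assoc _ _ _ ⟨
      (coord k x ⁻¹ * coord k x) * coord j y ≈⟨ *-congʳ (x⁻¹*x≈1 xₖ≉0) ⟩
      1# * coord j y                         ≈⟨ *-identityˡ _ ⟩
      coord j y                              ∎

  infix 4 _∼_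
  _∼_ : V³ → V³ → Set (c ⊔ ℓ)
  u ∼ w = ∃ λ t → t ≉ 0# × t · u ≈ⱽ w

  ·-assoc : ∀ s t u → s · (t · u) ≈ⱽ (s * t) · u
  ·-assoc s t u = sym (*-assoc s t _) , sym (*-assoc s t _) , sym (*-assoc s t _)

  1·u≈u : ∀ {s} u → s ≈ 1# → s · u ≈ⱽ u
  1·u≈u u s≈1 = one , one , one
    where
    one : ∀ {x} → _ * x ≈ x
    one = trans (*-congʳ s≈1) (*-identityˡ _)

  ∼-sym : ∀ {u w} → u ∼ w → w ∼ u
  ∼-sym {u} {w} (t , t≉0 , tu≈w) =
    t ⁻¹ , x⁻¹≉0 t≉0 , ≈ⱽ.trans (·-cong refl (≈ⱽ.sym tu≈w)) (≈ⱽ.trans (·-assoc (t ⁻¹) t u) (1·u≈u u (x⁻¹*x≈1 t≉0)))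

  ∼-trans : ∀ {u v w} → u ∼ v → v ∼ w → u ∼ w
  ∼-trans {u} (s , s≉0 , su≈v) (t , t≉0 , tv≈w) =
    t * s , x≉0∧y≉0⇒x*y≉0 t≉0 s≉0 , ≈ⱽ.trans (≈ⱽ.sym (·-assoc t s u)) (≈ⱽ.trans (·-cong refl su≈v) tv≈w)

  det-∼ˡ : ∀ {u u′} y z → u ∼ u′ → det u y z ≉ 0# → det u′ y z ≉ 0#
  det-∼ˡ {u} y z (t , t≉0 , tu≈u′) D≉0 D′≈0 =
    x≉0∧y≉0⇒x*y≉0 t≉0 D≉0 (trans (sym (det-*ˡ t u y z)) (trans (det-cong tu≈u′ ≈ⱽ.refl ≈ⱽ.refl) D′≈0))

  det-∼ᵐ : ∀ {u u′} x z → u ∼ u′ → det x u z ≉ 0# → det x u′ z ≉ 0#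
  det-∼ᵐ x z u∼u′ D≉0 D′≈0 =
    det-∼ˡ z x u∼u′ (λ D≈0 → D≉0 (trans (det-cyclic _ _ _) D≈0)) (trans (sym (det-cyclic _ _ _)) D′≈0)

  det-∼ʳ : ∀ {u u′} x y → u ∼ u′ → det x y u ≉ 0# → det x y u′ ≉ 0#
  det-∼ʳ x y u∼u′ D≉0 D′≈0 =
    det-∼ᵐ y x u∼u′ (λ D≈0 → D≉0 (trans (det-cyclic _ _ _) D≈0)) (trans (sym (det-cyclic _ _ _)) D′≈0)

  ∼⇒det≈0 : ∀ {x y} z → x ∼ y → det x y z ≈ 0#
  ∼⇒det≈0 {x} {y} z (t , _ , tx≈y) = begin
    det x y z       ≈⟨ det-cong ≈ⱽ.refl (≈ⱽ.sym tx≈y) ≈ⱽ.refl ⟩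
    det x (t · x) z ≈⟨ det-cyclic x (t · x) z ⟩
    det (t · x) z x ≈⟨ det-*ˡ t x z x ⟩
    t * det x z x   ≈⟨ *-congˡ (det-repeat₁₃ x z) ⟩
    t * 0#          ≈⟨ zeroʳ t ⟩
    0#              ∎

  det-0ᵐ : ∀ x z → det x (0³ F) z ≈ 0#
  det-0ᵐ x z = trans (det-cyclic x _ z) (det-0ˡ z x)

  det-0ʳ : ∀ x y → det x y (0³ F) ≈ 0#
  det-0ʳ x y = trans (sym (det-cyclic _ x y)) (det-0ˡ x y)

  det≉0⇒≉0ᵐ : ∀ {x y z} → det x y z ≉ 0# → ¬ (y ≈ⱽ 0³ F)
  det≉0⇒≉0ᵐ {x} {y} {z} D≉0 y≈0 = D≉0 (trans (det-cong ≈ⱽ.refl y≈0 ≈ⱽ.refl) (det-0ᵐ x z))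

  det≉0⇒LinIndep : ∀ {x y z} → det x y z ≉ 0# → LinIndep F x y z
  det≉0⇒LinIndep {x} {y} {z} D≉0 a b d comb≈0 =
      x*y≈0⇒y≈0 D≉0 (trans (*-comm _ a) (trans (sym (det-combˡ a b d x y z)) (trans (det-cong comb≈0 ≈ⱽ.refl ≈ⱽ.refl) (det-0ˡ y z))))
    , x*y≈0⇒y≈0 D≉0 (trans (*-comm _ b) (trans (sym (det-combᵐ a b d x y z)) (trans (det-cong ≈ⱽ.refl comb≈0 ≈ⱽ.refl) (det-0ᵐ x z))))
    , x*y≈0⇒y≈0 D≉0 (trans (*-comm _ d) (trans (sym (det-combʳ a b d x y z)) (trans (det-cong ≈ⱽ.refl ≈ⱽ.refl comb≈0) (det-0ʳ x y))))

  private
    0·u≈0 : ∀ {s} u → s ≈ 0# → s · u ≈ⱽ 0³ F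
    0·u≈0 u s≈0 = 0*x≈0 , 0*x≈0 , 0*x≈0
      where
      0*x≈0 : ∀ {x} → _ * x ≈ 0#
      0*x≈0 = trans (*-congʳ s≈0) (zeroˡ _)

    proportional-relation : ∀ {t a b} c → t * a ≈ b → (t * a + - 1# * b) + 0# * c ≈ 0#
    proportional-relation {t} {a} {b} c ta≈b = begin
      (t * a + - 1# * b) + 0# * c ≈⟨ solve 4 (λ t a b c → (t :* a :+ :- con (+ 1) :* b) :+ con (+ 0) :* c := t :* a :- b) refl t a b c ⟩
      t * a - b                   ≈⟨ +-congʳ ta≈b ⟩
      b - b                       ≈⟨ -‿inverseʳ b ⟩
      0#                          ∎

  cross≈0⇒∝ : ∀ {x y} → ¬ (x ≈ⱽ 0³ F) → cross x y ≈ⱽ 0³ F →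
              (coord (pick x) y * coord (pick x) x ⁻¹) · x ≈ⱽ y
  cross≈0⇒∝ {x} {y} x≉0 cross≈0 = proportional (pick x) (coord-pick≉0 x≉0) (cross≈0⇒minors≈0 cross≈0 (pick x))

  cross≈0⇒∼ : ∀ {x y} → ¬ (x ≈ⱽ 0³ F) → ¬ (y ≈ⱽ 0³ F) → cross x y ≈ⱽ 0³ F → x ∼ y
  cross≈0⇒∼ {x} {y} x≉0 y≉0 cross≈0 =
    _ , (λ t≈0 → y≉0 (≈ⱽ.trans (≈ⱽ.sym (cross≈0⇒∝ x≉0 cross≈0)) (0·u≈0 x t≈0))) , cross≈0⇒∝ x≉0 cross≈0

  -- If det x y z ≈ 0, Cramer's identity is a relation whose last coefficient is det x y w for
  -- any w; so the cross product of x and y vanishes, and y is a multiple of x.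
  LinIndep⇒det≉0 : ∀ {x y z} → ¬ (x ≈ⱽ 0³ F) → LinIndep F x y z → det x y z ≉ 0#
  LinIndep⇒det≉0 {x} {y} {z} x≉0 independent D≈0 =
    1≉0 (-x≈0⇒x≈0 (proj₁ (proj₂ (independent _ (- 1#) 0# relation))))
    where
    det-xy-≈0 : ∀ w → det x y w ≈ 0#
    det-xy-≈0 w = proj₂ (proj₂ (independent _ _ _ (≈ⱽ.trans (≈ⱽ.sym (cramer x y z w)) (0·u≈0 w D≈0))))
    cross≈0 : cross x y ≈ⱽ 0³ F
    cross≈0 = trans (sym (det-basis axis₁ x y)) (det-xy-≈0 _)
            , trans (sym (det-basis axis₂ x y)) (det-xy-≈0 _)
            , trans (sym (det-basis axis₃ x y)) (det-xy-≈0 _)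
    tx≈y : (coord (pick x) y * coord (pick x) x ⁻¹) · x ≈ⱽ y
    tx≈y = cross≈0⇒∝ x≉0 cross≈0
    relation : comb _ (- 1#) 0# x y z ≈ⱽ 0³ F
    relation = proportional-relation _ (proj₁ tx≈y)
             , proportional-relation _ (proj₁ (proj₂ tx≈y))
             , proportional-relation _ (proj₂ (proj₂ tx≈y))

  complement : V³ → V³ → V³
  complement x y = basis (pick (cross x y))

  det-complement≉0 : ∀ {x y} → ¬ (x ≈ⱽ 0³ F) → ¬ (y ≈ⱽ 0³ F) → ¬ (x ∼ y) → det x y (complement x y) ≉ 0#
  det-complement≉0 {x} {y} x≉0 y≉0 x≁y D≈0 =
    coord-pick≉0 (λ cross≈0 → x≁y (cross≈0⇒∼ x≉0 y≉0 cross≈0)) (trans (sym (det-basis (pick (cross x y)) x y)) D≈0)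

  ∼-refl : ∀ {u} → u ∼ u
  ∼-refl {u} = 1# , 1≉0 , 1·u≈u u refl

  ℙ² : Setoid (c ⊔ ℓ) (c ⊔ ℓ)
  ℙ² = record
    { Carrier       = Lift F
    ; _≈_           = SamePoint F
    ; isEquivalence = record { refl = ∼-refl ; sym = ∼-sym ; trans = ∼-trans }
    }

module ProjectivePlane {c ℓ} (F : Field c ℓ) {q : ℕ} (card : HasCardinality (Field._≈_ F) (λ _ → ⊤) q) where
  open Field F hiding (zero)
  open FiniteSetoid setoid card
  open FieldProperties F _≟_
  open Determinant F _≟_

  point₁ : Carrier → Carrier → Lift F
  point₁ a b = (1# , a , b) , λ (1≈0 , _) → 1≉0 1≈0

  point₂ : Carrier → Lift F
  point₂ a = (0# , 1# , a) , λ (_ , 1≈0 , _) → 1≉0 1≈0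

  point₃ : Lift F
  point₃ = (0# , 0# , 1#) , λ (_ , _ , 1≈0) → 1≉0 1≈0

  points : List (Lift F)
  points = cartesianProductWith point₁ elements elements ++ map point₂ elements ++ [ point₃ ]

  length-points : length points ≡ suc (q ℕ.* q ℕ.+ q)
  length-points = begin
    length (cartesianProductWith point₁ elements elements ++ map point₂ elements ++ [ point₃ ])
      ≡⟨ length-++ (cartesianProductWith point₁ elements elements) ⟩
    length (cartesianProductWith point₁ elements elements) ℕ.+ length (map point₂ elements ++ [ point₃ ])
      ≡⟨ ≡.cong₂ ℕ._+_ (length-cartesianProductWith point₁ elements elements) (length-++ (map point₂ elements)) ⟩
    length elements ℕ.* length elements ℕ.+ (length (map point₂ elements) ℕ.+ 1)
      ≡⟨ ≡.cong (λ l → length elements ℕ.* length elements ℕ.+ (l ℕ.+ 1)) (length-map point₂ elements) ⟩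
    length elements ℕ.* length elements ℕ.+ (length elements ℕ.+ 1)
      ≡⟨ ≡.cong (λ l → l ℕ.* l ℕ.+ (l ℕ.+ 1)) length-elements ⟩
    q ℕ.* q ℕ.+ (q ℕ.+ 1)
      ≡⟨ ≡.trans (≡.cong (q ℕ.* q ℕ.+_) (ℕ.+-comm q 1)) (ℕ.+-suc (q ℕ.* q) q) ⟩
    suc (q ℕ.* q ℕ.+ q) ∎
    where open ≡.≡-Reasoning

  ∈-points : ∀ v → Any (SamePoint F v) points
  ∈-points ((x₁ , x₂ , x₃) , v≉0) with x₁ ≟ 0# | x₂ ≟ 0# | x₃ ≟ 0#
  ... | no x₁≉0 | _ | _ =
    Any.++⁺ˡ (Any.cartesianProductWith⁺ point₁ (λ { ≡.refl ≡.refl → v∼ }) (representative-∈ (x₁ ⁻¹ * x₂)) (representative-∈ (x₁ ⁻¹ * x₃)))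
    where
    v∼ : (x₁ , x₂ , x₃) ∼ (1# , representative (x₁ ⁻¹ * x₂) , representative (x₁ ⁻¹ * x₃))
    v∼ = x₁ ⁻¹ , x⁻¹≉0 x₁≉0 , x⁻¹*x≈1 x₁≉0 , ≈-representative _ , ≈-representative _
  ... | yes x₁≈0 | no x₂≉0 | _ =
    Any.++⁺ʳ (cartesianProductWith point₁ elements elements) (Any.++⁺ˡ (Any.map⁺ (Any.map (λ { ≡.refl → v∼ }) (representative-∈ _))))
    where
    v∼ : (x₁ , x₂ , x₃) ∼ (0# , 1# , representative (x₂ ⁻¹ * x₃))
    v∼ = x₂ ⁻¹ , x⁻¹≉0 x₂≉0 , trans (*-congˡ x₁≈0) (zeroʳ _) , x⁻¹*x≈1 x₂≉0 , ≈-representative _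
  ... | yes x₁≈0 | yes x₂≈0 | no x₃≉0 =
    Any.++⁺ʳ (cartesianProductWith point₁ elements elements) (Any.++⁺ʳ (map point₂ elements) (here v∼))
    where
    v∼ : (x₁ , x₂ , x₃) ∼ (0# , 0# , 1#)
    v∼ = x₃ ⁻¹ , x⁻¹≉0 x₃≉0 , trans (*-congˡ x₁≈0) (zeroʳ _) , trans (*-congˡ x₂≈0) (zeroʳ _) , x⁻¹*x≈1 x₃≉0
  ... | yes x₁≈0 | yes x₂≈0 | yes x₃≈0 = ⊥-elim (v≉0 (x₁≈0 , x₂≈0 , x₃≈0))

  private
    t*1≈x⇒t≈x : ∀ {t x} → t * 1# ≈ x → t ≈ x
    t*1≈x⇒t≈x t*1≈x = trans (sym (*-identityʳ _)) t*1≈x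

    t≈1⇒x≈y : ∀ {t x y} → t ≈ 1# → t * x ≈ y → x ≈ y
    t≈1⇒x≈y t≈1 tx≈y = trans (sym (*-identityˡ _)) (trans (*-congʳ (sym t≈1)) tx≈y)

    ≁₁₂ : ∀ {a b c} → ¬ SamePoint F (point₁ a b) (point₂ c)
    ≁₁₂ (t , t≉0 , t*1≈0 , _) = t≉0 (t*1≈x⇒t≈x t*1≈0)

    ≁₁₃ : ∀ {a b} → ¬ SamePoint F (point₁ a b) point₃
    ≁₁₃ (t , t≉0 , t*1≈0 , _) = t≉0 (t*1≈x⇒t≈x t*1≈0)

    ≁₂₃ : ∀ {a} → ¬ SamePoint F (point₂ a) point₃
    ≁₂₃ (t , t≉0 , _ , t*1≈0 , _) = t≉0 (t*1≈x⇒t≈x t*1≈0)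

    point₁-injective : ∀ {a a′ b b′} → SamePoint F (point₁ a b) (point₁ a′ b′) → a ≈ a′ × b ≈ b′
    point₁-injective (t , _ , t*1≈1 , ta≈a′ , tb≈b′) =
      t≈1⇒x≈y (t*1≈x⇒t≈x t*1≈1) ta≈a′ , t≈1⇒x≈y (t*1≈x⇒t≈x t*1≈1) tb≈b′

    point₂-injective : ∀ {a a′} → SamePoint F (point₂ a) (point₂ a′) → a ≈ a′
    point₂-injective (t , _ , _ , t*1≈1 , ta≈a′) = t≈1⇒x≈y (t*1≈x⇒t≈x t*1≈1) ta≈a′

  points-distinct : AllPairs (λ u w → ¬ SamePoint F u w) points
  points-distinct =
    AllPairs.++⁺ (Unique.cartesianProductWith⁺ setoid setoid ℙ² point₁ point₁-injective elements-distinct elements-distinct)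
      (AllPairs.++⁺ (Unique.map⁺ setoid ℙ² point₂-injective elements-distinct) ([] ∷ [])
                    (All.map⁺ (All.universal (λ _ → ≁₂₃ ∷ []) elements)))
      (All.cartesianProductWith⁺ setoid setoid point₁ elements elements
        (λ _ _ → All.++⁺ (All.map⁺ (All.universal (λ _ → ≁₁₂) elements)) (≁₁₃ ∷ [])))

module States {c ℓ} (F : Field c ℓ) (_≟_ : Decidable (Field._≈_ F)) where
  open Field F
  open FieldProperties F _≟_
  open ℤ-CoefficientSolver commutativeRing′ using (solve; _:=_; _:+_; _:*_; :-_; _:-_; con)

  -- a: coordinates of the first point A in the current frame (u₁, u₂, u₃); lᵢ = det(A, B, uᵢ).
  record State : Set c where
    constructor state
    field a₁ a₂ a₃ l₁ l₂ l₃ : Carrier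
  open State public

  step : Carrier → Carrier → State → State
  step β γ (state a₁ a₂ a₃ l₁ l₂ l₃) = state (a₂ - a₁ * β) (a₃ - a₁ * γ) a₁ l₂ l₃ ((l₁ + β * l₂) + γ * l₃)

  classify : (a₁≈0 l₃≈0 a₂≈0 l₂≈0 : Bool) → Class
  classify false false _     _     = cf
  classify false true  _     _     = cd
  classify true  false _     _     = ce
  classify true  true  false _     = cc
  classify true  true  true  false = cb
  classify true  true  true  true  = ca

  isZero : Carrier → Bool
  isZero x = does (x ≟ 0#)

  class : State → Class
  class s = classify (isZero (a₁ s)) (isZero (l₃ s)) (isZero (a₂ s)) (isZero (l₂ s))

  HasClass : State → Class → Set ℓ
  HasClass s ca = (a₁ s ≈ 0#) × (l₃ s ≈ 0#) × (a₂ s ≈ 0#) × (l₂ s ≈ 0#)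
  HasClass s cb = (a₁ s ≈ 0#) × (l₃ s ≈ 0#) × (a₂ s ≈ 0#) × (l₂ s ≉ 0#)
  HasClass s cc = (a₁ s ≈ 0#) × (l₃ s ≈ 0#) × (a₂ s ≉ 0#)
  HasClass s cd = (a₁ s ≉ 0#) × (l₃ s ≈ 0#)
  HasClass s ce = (a₁ s ≈ 0#) × (l₃ s ≉ 0#)
  HasClass s cf = (a₁ s ≉ 0#) × (l₃ s ≉ 0#)

  hasClass-class : ∀ s → HasClass s (class s)
  hasClass-class s with a₁ s ≟ 0# | l₃ s ≟ 0# | a₂ s ≟ 0# | l₂ s ≟ 0#
  ... | no a₁≉0  | no l₃≉0  | _        | _        = a₁≉0 , l₃≉0
  ... | no a₁≉0  | yes l₃≈0 | _        | _        = a₁≉0 , l₃≈0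
  ... | yes a₁≈0 | no l₃≉0  | _        | _        = a₁≈0 , l₃≉0
  ... | yes a₁≈0 | yes l₃≈0 | no a₂≉0  | _        = a₁≈0 , l₃≈0 , a₂≉0
  ... | yes a₁≈0 | yes l₃≈0 | yes a₂≈0 | no l₂≉0  = a₁≈0 , l₃≈0 , a₂≈0 , l₂≉0
  ... | yes a₁≈0 | yes l₃≈0 | yes a₂≈0 | yes l₂≈0 = a₁≈0 , l₃≈0 , a₂≈0 , l₂≈0

  private
    class≡classify : ∀ s {b₁ b₂ b₃ b₄} → isZero (a₁ s) ≡ b₁ → isZero (l₃ s) ≡ b₂ → isZero (a₂ s) ≡ b₃ →
                     isZero (l₂ s) ≡ b₄ → class s ≡ classify b₁ b₂ b₃ b₄
    class≡classify s ≡.refl ≡.refl ≡.refl ≡.refl = ≡.refl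

    isZero-≈ : ∀ {x} → x ≈ 0# → isZero x ≡ true
    isZero-≈ = dec-true (_ ≟ 0#)

    isZero-≉ : ∀ {x} → x ≉ 0# → isZero x ≡ false
    isZero-≉ = dec-false (_ ≟ 0#)

  class-hasClass : ∀ s c → HasClass s c → class s ≡ c
  class-hasClass s ca (a₁≈0 , l₃≈0 , a₂≈0 , l₂≈0) =
    class≡classify s (isZero-≈ a₁≈0) (isZero-≈ l₃≈0) (isZero-≈ a₂≈0) (isZero-≈ l₂≈0)
  class-hasClass s cb (a₁≈0 , l₃≈0 , a₂≈0 , l₂≉0) =
    class≡classify s (isZero-≈ a₁≈0) (isZero-≈ l₃≈0) (isZero-≈ a₂≈0) (isZero-≉ l₂≉0)
  class-hasClass s cc (a₁≈0 , l₃≈0 , a₂≉0)        = class≡classify s (isZero-≈ a₁≈0) (isZero-≈ l₃≈0) (isZero-≉ a₂≉0) ≡.refl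
  class-hasClass s cd (a₁≉0 , l₃≈0)               = class≡classify s (isZero-≉ a₁≉0) (isZero-≈ l₃≈0) ≡.refl ≡.refl
  class-hasClass s ce (a₁≈0 , l₃≉0)               = class≡classify s (isZero-≈ a₁≈0) (isZero-≉ l₃≉0) ≡.refl ≡.refl
  class-hasClass s cf (a₁≉0 , l₃≉0)               = class≡classify s (isZero-≉ a₁≉0) (isZero-≉ l₃≉0) ≡.refl ≡.refl

  AllZero : Carrier → Carrier → Carrier → Set ℓ
  AllZero x y z = (x ≈ 0#) × (y ≈ 0#) × (z ≈ 0#)

  -- l · a = det(A, B, A) = 0, and a, l ≠ 0 since the frame is a basis and A, B are independent.
  Invariant : State → Set ℓ
  Invariant s = ((l₁ s * a₁ s + l₂ s * a₂ s) + l₃ s * a₃ s ≈ 0#)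
              × ¬ AllZero (a₁ s) (a₂ s) (a₃ s) × ¬ AllZero (l₁ s) (l₂ s) (l₃ s)
  step-invariant : ∀ β γ s → Invariant s → Invariant (step β γ s)
  step-invariant β γ s (l·a≈0 , a≉0 , l≉0) = l·a′≈0 , a′≉0 , l′≉0
    where
    l·a′≈0 : (l₂ s * (a₂ s - a₁ s * β) + l₃ s * (a₃ s - a₁ s * γ)) + ((l₁ s + β * l₂ s) + γ * l₃ s) * a₁ s ≈ 0#
    l·a′≈0 = trans (solve 8 (λ a₁ a₂ a₃ l₁ l₂ l₃ β γ →
                      (l₂ :* (a₂ :- a₁ :* β) :+ l₃ :* (a₃ :- a₁ :* γ)) :+ ((l₁ :+ β :* l₂) :+ γ :* l₃) :* a₁
                      := (l₁ :* a₁ :+ l₂ :* a₂) :+ l₃ :* a₃) refl (a₁ s) (a₂ s) (a₃ s) (l₁ s) (l₂ s) (l₃ s) β γ)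
                   l·a≈0
    a′≉0 : ¬ AllZero (a₂ s - a₁ s * β) (a₃ s - a₁ s * γ) (a₁ s)
    a′≉0 (a₁′≈0 , a₂′≈0 , a₁≈0) =
      a≉0 (a₁≈0 , trans (sym (x-0*y≈x β a₁≈0)) a₁′≈0 , trans (sym (x-0*y≈x γ a₁≈0)) a₂′≈0)
    l′≉0 : ¬ AllZero (l₂ s) (l₃ s) ((l₁ s + β * l₂ s) + γ * l₃ s)
    l′≉0 (l₂≈0 , l₃≈0 , l₃′≈0) =
      l≉0 (trans (sym (trans (x+y*0≈x γ l₃≈0) (x+y*0≈x β l₂≈0))) l₃′≈0 , l₂≈0 , l₃≈0)

  l·a≈0-at-l₃≈0 : ∀ s → Invariant s → l₃ s ≈ 0# → l₁ s * a₁ s + l₂ s * a₂ s ≈ 0#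
  l·a≈0-at-l₃≈0 s (l·a≈0 , _) l₃≈0 = trans (sym (x+y*0≈x (a₃ s) l₃≈0)) (trans (+-congˡ (*-comm _ _)) l·a≈0)

  l₁+[a₂/a₁]l₂≈0 : ∀ s → Invariant s → l₃ s ≈ 0# → a₁ s ≉ 0# → l₁ s + (a₂ s * a₁ s ⁻¹) * l₂ s ≈ 0#
  l₁+[a₂/a₁]l₂≈0 s inv l₃≈0 a₁≉0 = begin
    l₁ s + (a₂ s * a₁ s ⁻¹) * l₂ s
      ≈⟨ solve 5 (λ l₁ l₂ a₁ a₂ w → l₁ :+ (a₂ :* w) :* l₂ := (l₁ :* a₁ :+ l₂ :* a₂) :* w :+ (l₁ :- l₁ :* (a₁ :* w)))
                 refl (l₁ s) (l₂ s) (a₁ s) (a₂ s) (a₁ s ⁻¹) ⟩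
    (l₁ s * a₁ s + l₂ s * a₂ s) * a₁ s ⁻¹ + (l₁ s - l₁ s * (a₁ s * a₁ s ⁻¹))
      ≈⟨ +-cong (trans (*-congʳ (l·a≈0-at-l₃≈0 s inv l₃≈0)) (zeroˡ _)) (+-congˡ (-‿cong (*-congˡ (x*x⁻¹≈1 a₁≉0)))) ⟩
    0# + (l₁ s - l₁ s * 1#)
      ≈⟨ solve 1 (λ l → con (+ 0) :+ (l :- l :* con (+ 1)) := con (+ 0)) refl (l₁ s) ⟩
    0# ∎
    where open import Relation.Binary.Reasoning.Setoid setoid

  a₃-a₁γ≈0 : ∀ s {β γ} → Invariant s → a₁ s ≉ 0# → l₃ s ≉ 0# → β ≈ a₂ s * a₁ s ⁻¹ →
             γ ≈ - (l₁ s + β * l₂ s) * l₃ s ⁻¹ → a₃ s - a₁ s * γ ≈ 0#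
  a₃-a₁γ≈0 s {β} {γ} (l·a≈0 , _) a₁≉0 l₃≉0 β≈β₀ γ≈γ₀ = begin
    a₃ s - a₁ s * γ
      ≈⟨ +-congˡ (-‿cong (*-congˡ γ≈γ₀)) ⟩
    a₃ s - a₁ s * (- (l₁ s + β * l₂ s) * l₃ s ⁻¹)
      ≈⟨ solve 7 (λ a₁ a₃ l₁ l₂ l₃ b w → a₃ :- a₁ :* (:- (l₁ :+ b :* l₂) :* w)
                   := ((l₁ :* a₁ :+ (a₁ :* b) :* l₂) :+ l₃ :* a₃) :* w :+ (a₃ :- a₃ :* (l₃ :* w)))
                 refl (a₁ s) (a₃ s) (l₁ s) (l₂ s) (l₃ s) β (l₃ s ⁻¹) ⟩
    ((l₁ s * a₁ s + (a₁ s * β) * l₂ s) + l₃ s * a₃ s) * l₃ s ⁻¹ + (a₃ s - a₃ s * (l₃ s * l₃ s ⁻¹))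
      ≈⟨ +-cong (*-congʳ (+-congʳ (+-congˡ (trans (*-congʳ a₁β≈a₂) (*-comm _ _))))) (+-congˡ (-‿cong (*-congˡ (x*x⁻¹≈1 l₃≉0)))) ⟩
    ((l₁ s * a₁ s + l₂ s * a₂ s) + l₃ s * a₃ s) * l₃ s ⁻¹ + (a₃ s - a₃ s * 1#)
      ≈⟨ +-cong (trans (*-congʳ l·a≈0) (zeroˡ _)) (solve 1 (λ a → a :- a :* con (+ 1) := con (+ 0)) refl (a₃ s)) ⟩
    0# + 0#
      ≈⟨ +-identityˡ 0# ⟩
    0# ∎
    where
    open import Relation.Binary.Reasoning.Setoid setoid
    a₁β≈a₂ : a₁ s * β ≈ a₂ s
    a₁β≈a₂ = x-y≈0⇒x≈y (trans (solve 2 (λ x y → x :- y := :- (y :- x)) refl _ _)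
               (trans (-‿cong (x≈c*u⁻¹⇒c-u*x≈0 a₁≉0 β≈β₀)) (solve 0 (:- con (+ 0) := con (+ 0)) refl)))

  Letter : Set c
  Letter = Carrier × Carrier

  advance : Letter → State → State
  advance (β , γ) = step β γ

module Successors {c ℓ} (F : Field c ℓ) (p : ℕ) (card : HasCardinality (Field._≈_ F) (λ _ → ⊤) (suc p)) where
  open Field F
  open FiniteSetoid setoid card using (_≟_; elements; sumOver; sumOver-const; sumOver-except)
  open FieldProperties F _≟_
  open States F _≟_
  open ClassCounts p using (transfer; classCount)

  successors : State → (Class → ℕ) → ℕ
  successors s H = sumOver (λ β → sumOver (λ γ → H (class (step β γ s))))

  successors-ca : ∀ s → Invariant s → HasClass s ca → ∀ H → successors s H ≡ transfer H ca
  successors-ca s (_ , _ , l≉0) (a₁≈0 , l₃≈0 , a₂≈0 , l₂≈0) H =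
    sumOver-const _ λ β → sumOver-const (λ γ → H (class (step β γ s))) λ γ → ≡.cong H (class-hasClass (step β γ s) ce
      ( trans (x-0*y≈x β a₁≈0) a₂≈0
      , ≉-resp-≈ (trans (x+y*0≈x γ l₃≈0) (x+y*0≈x β l₂≈0)) (λ l₁≈0 → l≉0 (l₁≈0 , l₂≈0 , l₃≈0))))

  successors-cb : ∀ s → Invariant s → HasClass s cb → ∀ H → successors s H ≡ transfer H cb
  successors-cb s (_ , a≉0 , _) (a₁≈0 , l₃≈0 , a₂≈0 , l₂≉0) H =
    sumOver-except _ (- l₁ s * l₂ s ⁻¹)
      (λ β β≈β₀ → sumOver-const (λ γ → H (class (step β γ s))) λ γ → ≡.cong H (class-hasClass (step β γ s) cc
        ( trans (x-0*y≈x β a₁≈0) a₂≈0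
        , trans (x+y*0≈x γ l₃≈0) (x≈-c*u⁻¹⇒c+x*u≈0 l₂≉0 β≈β₀)
        , ≉-resp-≈ (x-0*y≈x γ a₁≈0) (λ a₃≈0 → a≉0 (a₁≈0 , a₂≈0 , a₃≈0)))))
      (λ β β≉β₀ → sumOver-const (λ γ → H (class (step β γ s))) λ γ → ≡.cong H (class-hasClass (step β γ s) ce
        ( trans (x-0*y≈x β a₁≈0) a₂≈0
        , λ l₃′≈0 → β≉β₀ (c+x*u≈0⇒x≈-c*u⁻¹ l₂≉0 (trans (sym (x+y*0≈x γ l₃≈0)) l₃′≈0)))))

  successors-cc : ∀ s → Invariant s → HasClass s cc → ∀ H → successors s H ≡ transfer H cc
  successors-cc s inv@(_ , _ , l≉0) (a₁≈0 , l₃≈0 , a₂≉0) H =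
    sumOver-const _ λ β → sumOver-const (λ γ → H (class (step β γ s))) λ γ → ≡.cong H (class-hasClass (step β γ s) cf
      ( ≉-resp-≈ (x-0*y≈x β a₁≈0) a₂≉0
      , ≉-resp-≈ (trans (x+y*0≈x γ l₃≈0) (x+y*0≈x β l₂≈0)) (λ l₁≈0 → l≉0 (l₁≈0 , l₂≈0 , l₃≈0))))
    where
    l₂≈0 : l₂ s ≈ 0#
    l₂≈0 = x*y≈0⇒y≈0 a₂≉0 (trans (*-comm _ _) (trans (sym (+-identityˡ _))
             (trans (+-congʳ (sym (trans (*-congˡ a₁≈0) (zeroʳ _)))) (l·a≈0-at-l₃≈0 s inv l₃≈0))))

  successors-cd : ∀ s → Invariant s → HasClass s cd → ∀ H → successors s H ≡ transfer H cd
  successors-cd s inv@(_ , _ , l≉0) (a₁≉0 , l₃≈0) H =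
    sumOver-except _ β₀
      (λ β β≈β₀ → sumOver-except (λ γ → H (class (step β γ s))) (a₃ s * a₁ s ⁻¹)
         (λ γ γ≈γ₀ → ≡.cong H (class-hasClass (step β γ s) ca
            (x≈c*u⁻¹⇒c-u*x≈0 a₁≉0 β≈β₀ , l₃′≈0 β β≈β₀ γ , x≈c*u⁻¹⇒c-u*x≈0 a₁≉0 γ≈γ₀ , l₃≈0)))
         (λ γ γ≉γ₀ → ≡.cong H (class-hasClass (step β γ s) cc
            (x≈c*u⁻¹⇒c-u*x≈0 a₁≉0 β≈β₀ , l₃′≈0 β β≈β₀ γ , λ a₂′≈0 → γ≉γ₀ (c-u*x≈0⇒x≈c*u⁻¹ a₁≉0 a₂′≈0)))))
      (λ β β≉β₀ → sumOver-const (λ γ → H (class (step β γ s))) λ γ → ≡.cong H (class-hasClass (step β γ s) cf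
         ( (λ a₁′≈0 → β≉β₀ (c-u*x≈0⇒x≈c*u⁻¹ a₁≉0 a₁′≈0))
         , λ l₃′≈0 → β≉β₀ (root-unique β (trans (sym (x+y*0≈x γ l₃≈0)) l₃′≈0)))))
    where
    β₀ = a₂ s * a₁ s ⁻¹
    l₁+β₀l₂≈0 : l₁ s + β₀ * l₂ s ≈ 0#
    l₁+β₀l₂≈0 = l₁+[a₂/a₁]l₂≈0 s inv l₃≈0 a₁≉0
    l₃′≈0 : ∀ β → β ≈ β₀ → ∀ γ → (l₁ s + β * l₂ s) + γ * l₃ s ≈ 0#
    l₃′≈0 β β≈β₀ γ = trans (x+y*0≈x γ l₃≈0) (trans (+-congˡ (*-congʳ β≈β₀)) l₁+β₀l₂≈0)
    root-unique : ∀ β → l₁ s + β * l₂ s ≈ 0# → β ≈ β₀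
    root-unique β l₁+βl₂≈0 with l₂ s ≟ 0#
    ... | yes l₂≈0 = ⊥-elim (l≉0 (trans (sym (x+y*0≈x β l₂≈0)) l₁+βl₂≈0 , l₂≈0 , l₃≈0))
    ... | no l₂≉0  = trans (c+x*u≈0⇒x≈-c*u⁻¹ l₂≉0 l₁+βl₂≈0) (sym (c+x*u≈0⇒x≈-c*u⁻¹ l₂≉0 l₁+β₀l₂≈0))

  successors-ce : ∀ s → Invariant s → HasClass s ce → ∀ H → successors s H ≡ transfer H ce
  successors-ce s (l·a≈0 , a≉0 , _) (a₁≈0 , l₃≉0) H =
    sumOver-const _ λ β → sumOver-except (λ γ → H (class (step β γ s))) (- (l₁ s + β * l₂ s) * l₃ s ⁻¹)
      (λ γ γ≈γ₀ → ≡.cong H (class-hasClass (step β γ s) cd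
         (≉-resp-≈ (x-0*y≈x β a₁≈0) a₂≉0 , x≈-c*u⁻¹⇒c+x*u≈0 l₃≉0 γ≈γ₀)))
      (λ γ γ≉γ₀ → ≡.cong H (class-hasClass (step β γ s) cf
         (≉-resp-≈ (x-0*y≈x β a₁≈0) a₂≉0 , λ l₃′≈0 → γ≉γ₀ (c+x*u≈0⇒x≈-c*u⁻¹ l₃≉0 l₃′≈0))))
    where
    a₂≉0 : a₂ s ≉ 0#
    a₂≉0 a₂≈0 = a≉0 (a₁≈0 , a₂≈0 , x*y≈0⇒y≈0 l₃≉0 (trans (sym (+-identityˡ _)) (trans (+-congʳ l·a′≈0) l·a≈0)))
      where
      l·a′≈0 : 0# ≈ l₁ s * a₁ s + l₂ s * a₂ s
      l·a′≈0 = sym (trans (+-cong (trans (*-congˡ a₁≈0) (zeroʳ _)) (trans (*-congˡ a₂≈0) (zeroʳ _))) (+-identityˡ 0#))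

  successors-cf : ∀ s → Invariant s → HasClass s cf → ∀ H → successors s H ≡ transfer H cf
  successors-cf s inv (a₁≉0 , l₃≉0) H =
    sumOver-except _ (a₂ s * a₁ s ⁻¹)
      (λ β β≈β₀ → sumOver-except (λ γ → H (class (step β γ s))) (γ₀ β)
         (λ γ γ≈γ₀ → ≡.cong H (class-hasClass (step β γ s) cb
            (x≈c*u⁻¹⇒c-u*x≈0 a₁≉0 β≈β₀ , x≈-c*u⁻¹⇒c+x*u≈0 l₃≉0 γ≈γ₀ , a₃-a₁γ≈0 s inv a₁≉0 l₃≉0 β≈β₀ γ≈γ₀ , l₃≉0)))
         (λ γ γ≉γ₀ → ≡.cong H (class-hasClass (step β γ s) ce
            (x≈c*u⁻¹⇒c-u*x≈0 a₁≉0 β≈β₀ , λ l₃′≈0 → γ≉γ₀ (c+x*u≈0⇒x≈-c*u⁻¹ l₃≉0 l₃′≈0)))))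
      (λ β β≉β₀ → sumOver-except (λ γ → H (class (step β γ s))) (γ₀ β)
         (λ γ γ≈γ₀ → ≡.cong H (class-hasClass (step β γ s) cd
            ((λ a₁′≈0 → β≉β₀ (c-u*x≈0⇒x≈c*u⁻¹ a₁≉0 a₁′≈0)) , x≈-c*u⁻¹⇒c+x*u≈0 l₃≉0 γ≈γ₀)))
         (λ γ γ≉γ₀ → ≡.cong H (class-hasClass (step β γ s) cf
            ((λ a₁′≈0 → β≉β₀ (c-u*x≈0⇒x≈c*u⁻¹ a₁≉0 a₁′≈0)) , λ l₃′≈0 → γ≉γ₀ (c+x*u≈0⇒x≈-c*u⁻¹ l₃≉0 l₃′≈0)))))
    where
    γ₀ : Carrier → Carrier
    γ₀ β = - (l₁ s + β * l₂ s) * l₃ s ⁻¹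

  successors-transfer : ∀ s → Invariant s → ∀ H → successors s H ≡ transfer H (class s)
  successors-transfer s inv H with class s | hasClass-class s
  ... | ca | has = successors-ca s inv has H
  ... | cb | has = successors-cb s inv has H
  ... | cc | has = successors-cc s inv has H
  ... | cd | has = successors-cd s inv has H
  ... | ce | has = successors-ce s inv has H
  ... | cf | has = successors-cf s inv has H

  letters : List Letter
  letters = cartesianProduct elements elements

  open Words letters advance (isFinal ∘ class) public

  length-words : ∀ m s → Invariant s → length (words m s) ≡ classCount m (class s)
  length-words zero    s _   = length-words-zero s
  length-words (suc m) s inv = begin
    length (words (suc m) s)
      ≡⟨ length-words-suc m s ⟩
    sum (map (λ x → length (words m (advance x s))) letters)
      ≡⟨ sum-cartesianProduct _ elements elements ⟩
    sumOver (λ β → sumOver (λ γ → length (words m (step β γ s))))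
      ≡⟨ sum-map-cong (λ β → sum-map-cong (λ γ → length-words m (step β γ s) (step-invariant β γ s inv)) elements) elements ⟩
    successors s (classCount m)
      ≡⟨ successors-transfer s inv (classCount m) ⟩
    classCount (suc m) (class s) ∎
    where open ≡.≡-Reasoning

toℕ-mod : ∀ {k n} .{{_ : ℕ.NonZero n}} → k < n → toℕ (k mod n) ≡ k
toℕ-mod {k} {n} k<n = ≡.trans (toℕ-fromℕ< _) (m<n⇒m%n≡m k<n)

toℕ-mod-toℕ : ∀ {n} .{{_ : ℕ.NonZero n}} (i : Fin n) → toℕ i mod n ≡ i
toℕ-mod-toℕ i = toℕ-injective (toℕ-mod (toℕ<n i))

[k+n]mod-n : ∀ k n .{{_ : ℕ.NonZero n}} → (k ℕ.+ n) mod n ≡ k mod n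
[k+n]mod-n k n = toℕ-injective (≡.trans (toℕ-fromℕ< _) (≡.trans ([m+n]%n≡m%n k n) (≡.sym (toℕ-fromℕ< _))))

module CyclicConfigurations {c ℓ} (F : Field c ℓ) (_≟_ : Decidable (Field._≈_ F)) where
  open Field F hiding (zero)
  open FieldProperties F _≟_
  open Determinant F _≟_

  -- The zero vector, which never occurs below, is sent to an arbitrary point.
  lift : V³ → Lift F
  lift v with (π₁ v ≟ 0#) ×-dec ((π₂ v ≟ 0#) ×-dec (π₃ v ≟ 0#))
  ... | yes _  = (0# , 0# , 1#) , λ (_ , _ , 1≈0) → 1≉0 1≈0
  ... | no v≉0 = v , v≉0

  lift-≉0 : ∀ {v} → ¬ (v ≈ⱽ 0³ F) → proj₁ (lift v) ≡ v
  lift-≉0 {v} v≉0 with (π₁ v ≟ 0#) ×-dec ((π₂ v ≟ 0#) ×-dec (π₃ v ≟ 0#))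
  ... | yes v≈0 = ⊥-elim (v≉0 v≈0)
  ... | no _    = ≡.refl

  private
    det≉0-subst : ∀ {a a′ b b′ c c′} → a ≡ a′ → b ≡ b′ → c ≡ c′ → det a b c ≉ 0# → det a′ b′ c′ ≉ 0#
    det≉0-subst ≡.refl ≡.refl ≡.refl D≉0 = D≉0

  InC₃-intro : ∀ m (P : ℕ → V³) → (∀ k → ¬ (P k ≈ⱽ 0³ F)) →
               (∀ k → k < m → det (P k) (P (1 ℕ.+ k)) (P (2 ℕ.+ k)) ≉ 0#) →
               det (P m) (P (1 ℕ.+ m)) (P 0) ≉ 0# → det (P (1 ℕ.+ m)) (P 0) (P 1) ≉ 0# →
               InC₃ F (2 ℕ.+ m) (λ i → lift (P (toℕ i)))
  InC₃-intro m P P≉0 consecutive closing₁ closing₂ i =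
    det≉0⇒LinIndep (det≉0-subst (≡.sym (lift-≉0 (P≉0 _)))
                                (≡.sym (≡.trans (lift-≉0 (P≉0 _)) (≡.cong P (toℕ-fromℕ< _))))
                                (≡.sym (≡.trans (lift-≉0 (P≉0 _)) (≡.cong P (toℕ-fromℕ< _))))
                                (at (toℕ i) (toℕ<n i)))
    where
    n = 2 ℕ.+ m
    at : ∀ k → k < n → det (P k) (P ((k ℕ.+ 1) % n)) (P ((k ℕ.+ 2) % n)) ≉ 0#
    at k k<n with ℕ.m<1+n⇒m<n∨m≡n k<n
    ... | inj₂ ≡.refl = det≉0-subst ≡.refl
                          (≡.cong P (≡.sym (≡.trans (≡.cong (_% n) (ℕ.+-comm (1 ℕ.+ m) 1)) (n%n≡0 n))))
                          (≡.cong P (≡.sym (≡.trans (≡.cong (_% n) (ℕ.+-comm (1 ℕ.+ m) 2)) ([m+n]%n≡m%n 1 n))))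
                          closing₂
    ... | inj₁ k<1+m with ℕ.m<1+n⇒m<n∨m≡n k<1+m
    ...   | inj₂ ≡.refl = det≉0-subst ≡.refl
                            (≡.cong P (≡.sym (≡.trans (≡.cong (_% n) (ℕ.+-comm m 1)) (m<n⇒m%n≡m (ℕ.n<1+n (1 ℕ.+ m))))))
                            (≡.cong P (≡.sym (≡.trans (≡.cong (_% n) (ℕ.+-comm m 2)) (n%n≡0 n))))
                            closing₁
    ...   | inj₁ k<m    = det≉0-subst ≡.refl
                            (≡.cong P (≡.sym (≡.trans (≡.cong (_% n) (ℕ.+-comm k 1)) (m<n⇒m%n≡m (s≤s (ℕ.m≤n⇒m≤1+n k<m))))))
                            (≡.cong P (≡.sym (≡.trans (≡.cong (_% n) (ℕ.+-comm k 2)) (m<n⇒m%n≡m (s≤s (s≤s k<m))))))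
                            (consecutive k k<m)

  point : ∀ {n} → Tuple F (suc n) → ℕ → V³
  point {n} vs k = proj₁ (vs (k mod suc n))

  point-toℕ : ∀ {n} (vs : Tuple F (suc n)) i → point vs (toℕ i) ≡ proj₁ (vs i)
  point-toℕ vs i = ≡.cong (proj₁ ∘ vs) (toℕ-mod-toℕ i)

  point-+n : ∀ {n} (vs : Tuple F (suc n)) k → point vs (k ℕ.+ suc n) ≡ point vs k
  point-+n {n} vs k = ≡.cong (proj₁ ∘ vs) ([k+n]mod-n k (suc n))

  InC₃-elim : ∀ {n} (vs : Tuple F (suc n)) → InC₃ F (suc n) vs → ∀ k → k < suc n →
              det (point vs k) (point vs (1 ℕ.+ k)) (point vs (2 ℕ.+ k)) ≉ 0#
  InC₃-elim {n} vs inC₃ k k<n =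
    det≉0-subst first (index 1) (index 2) (LinIndep⇒det≉0 (proj₂ (vs i)) (inC₃ i))
    where
    i = fromℕ< k<n
    first : proj₁ (vs i) ≡ point vs k
    first = ≡.trans (≡.sym (point-toℕ vs i)) (≡.cong (point vs) (toℕ-fromℕ< k<n))
    index : ∀ j → proj₁ (vs ((toℕ i ℕ.+ j) mod suc n)) ≡ point vs (j ℕ.+ k)
    index j = ≡.cong (λ l → point vs l) (≡.trans (≡.cong (ℕ._+ j) (toℕ-fromℕ< k<n)) (ℕ.+-comm k j))

module Frames {c ℓ} (F : Field c ℓ) (_≟_ : Decidable (Field._≈_ F)) where
  open Field F hiding (zero)
  open FieldProperties F _≟_
  open Determinant F _≟_
  open States F _≟_
  open ℤ-CoefficientSolver commutativeRing′ using (solve; _:=_; _:+_; _:*_; :-_; _:-_; con)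
  open import Relation.Binary.Reasoning.Setoid setoid

  Frame : Set c
  Frame = V³ × V³ × V³

  advanceFrame : Letter → Frame → Frame
  advanceFrame (β , γ) (u₁ , u₂ , u₃) = u₂ , u₃ , comb 1# β γ u₁ u₂ u₃

  frameDet : Frame → Carrier
  frameDet (u₁ , u₂ , u₃) = det u₁ u₂ u₃

  frameDet-advance : ∀ x fr → frameDet (advanceFrame x fr) ≈ frameDet fr
  frameDet-advance (β , γ) (u₁ , u₂ , u₃) = begin
    det u₂ u₃ (comb 1# β γ u₁ u₂ u₃) ≈⟨ trans (det-cyclic _ _ _) (det-cyclic _ _ _) ⟩
    det (comb 1# β γ u₁ u₂ u₃) u₂ u₃ ≈⟨ det-combˡ 1# β γ u₁ u₂ u₃ ⟩
    1# * det u₁ u₂ u₃                ≈⟨ *-identityˡ _ ⟩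
    det u₁ u₂ u₃                     ∎

  frameAt : Frame → (ℕ → Letter) → ℕ → Frame
  frameAt fr f zero    = fr
  frameAt fr f (suc k) = frameAt (advanceFrame (f 0) fr) (f ∘ suc) k

  frameAt-suc : ∀ fr f k → frameAt fr f (suc k) ≡ advanceFrame (f k) (frameAt fr f k)
  frameAt-suc fr f zero    = ≡.refl
  frameAt-suc fr f (suc k) = frameAt-suc (advanceFrame (f 0) fr) (f ∘ suc) k

  frameDet-frameAt : ∀ fr f k → frameDet (frameAt fr f k) ≈ frameDet fr
  frameDet-frameAt fr f zero    = refl
  frameDet-frameAt fr f (suc k) = trans (frameDet-frameAt (advanceFrame (f 0) fr) (f ∘ suc) k) (frameDet-advance (f 0) fr)

  module Tracking (A B : V³) where

    Tracks : State → Frame → Set ℓ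
    Tracks s (u₁ , u₂ , u₃) = (A ≈ⱽ comb (a₁ s) (a₂ s) (a₃ s) u₁ u₂ u₃)
                            × (l₁ s ≈ det A B u₁) × (l₂ s ≈ det A B u₂) × (l₃ s ≈ det A B u₃)

    tracks-advance : ∀ x s fr → Tracks s fr → Tracks (advance x s) (advanceFrame x fr)
    tracks-advance (β , γ) s (u₁ , u₂ , u₃) (A≈ , l₁≈ , l₂≈ , l₃≈) =
      ≈ⱽ.trans A≈ ( coordinates (π₁ u₁) (π₁ u₂) (π₁ u₃)
                  , coordinates (π₂ u₁) (π₂ u₂) (π₂ u₃)
                  , coordinates (π₃ u₁) (π₃ u₂) (π₃ u₃)) ,
      l₂≈ , l₃≈ ,
      trans (+-cong (+-cong (trans l₁≈ (sym (*-identityˡ _))) (*-congˡ l₂≈)) (*-congˡ l₃≈)) (sym (det-linearʳ 1# β γ A B u₁ u₂ u₃))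
      where
      coordinates : ∀ x y z → (a₁ s * x + a₂ s * y) + a₃ s * z
                              ≈ ((a₂ s - a₁ s * β) * y + (a₃ s - a₁ s * γ) * z) + a₁ s * ((1# * x + β * y) + γ * z)
      coordinates x y z = solve 8 (λ a₁ a₂ a₃ β γ x y z →
                            (a₁ :* x :+ a₂ :* y) :+ a₃ :* z
                            := ((a₂ :- a₁ :* β) :* y :+ (a₃ :- a₁ :* γ) :* z) :+ a₁ :* ((con (+ 1) :* x :+ β :* y) :+ γ :* z))
                          refl (a₁ s) (a₂ s) (a₃ s) β γ x y z

    a₁≉0⇔det≉0 : ∀ s u₁ u₂ u₃ → Tracks s (u₁ , u₂ , u₃) → det u₁ u₂ u₃ ≉ 0# →
                  (a₁ s ≉ 0# → det u₂ u₃ A ≉ 0#) × (det u₂ u₃ A ≉ 0# → a₁ s ≉ 0#)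
    a₁≉0⇔det≉0 s u₁ u₂ u₃ (A≈ , _) D≉0 =
        (λ a₁≉0 D′≈0 → x≉0∧y≉0⇒x*y≉0 a₁≉0 D≉0 (trans (sym det-u₂u₃A) D′≈0))
      , (λ D′≉0 a₁≈0 → D′≉0 (trans det-u₂u₃A (trans (*-congʳ a₁≈0) (zeroˡ _))))
      where
      det-u₂u₃A : det u₂ u₃ A ≈ a₁ s * det u₁ u₂ u₃
      det-u₂u₃A = begin
        det u₂ u₃ A                ≈⟨ det-cong ≈ⱽ.refl ≈ⱽ.refl A≈ ⟩
        det u₂ u₃ (comb _ _ _ u₁ u₂ u₃) ≈⟨ trans (det-cyclic _ _ _) (det-cyclic _ _ _) ⟩
        det (comb _ _ _ u₁ u₂ u₃) u₂ u₃ ≈⟨ det-combˡ _ _ _ u₁ u₂ u₃ ⟩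
        a₁ s * det u₁ u₂ u₃        ∎

    l₃≉0⇔det≉0 : ∀ s u₁ u₂ u₃ → Tracks s (u₁ , u₂ , u₃) →
                  (l₃ s ≉ 0# → det u₃ A B ≉ 0#) × (det u₃ A B ≉ 0# → l₃ s ≉ 0#)
    l₃≉0⇔det≉0 s u₁ u₂ u₃ (_ , _ , _ , l₃≈) =
        (λ l₃≉0 D≈0 → l₃≉0 (trans l₃≈ (trans (sym (det-cyclic u₃ A B)) D≈0)))
      , (λ D≉0 l₃≈0 → D≉0 (trans (det-cyclic u₃ A B) (trans (sym l₃≈) l₃≈0)))

    initialState : State
    initialState = state 0# 1# 0# (det A B (complement A B)) 0# 0#

    initialFrame : Frame
    initialFrame = complement A B , A , B

    tracks-initial : Tracks initialState initialFrame
    tracks-initial = (A≈ (π₁ A) (π₁ W) (π₁ B) , A≈ (π₂ A) (π₂ W) (π₂ B) , A≈ (π₃ A) (π₃ W) (π₃ B)) ,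
                     refl , sym (det-repeat₁₃ A B) , sym (det-repeat₂₃ A B)
      where
      W = complement A B
      A≈ : ∀ a w b → a ≈ (0# * w + 1# * a) + 0# * b
      A≈ a w b = solve 3 (λ a w b → a := (con (+ 0) :* w :+ con (+ 1) :* a) :+ con (+ 0) :* b) refl a w b

    invariant-initial : det A B (complement A B) ≉ 0# → Invariant initialState
    invariant-initial D≉0 =
      solve 1 (λ d → (d :* con (+ 0) :+ con (+ 0) :* con (+ 1)) :+ con (+ 0) :* con (+ 0) := con (+ 0)) refl _ ,
      (λ (_ , 1≈0 , _) → 1≉0 1≈0) ,
      (λ (D≈0 , _) → D≉0 D≈0)

    class-initial : class initialState ≡ cc
    class-initial = class-hasClass initialState cc (refl , refl , 1≉0)

  middle newPoint : Frame → V³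
  middle   (_ , u₂ , _) = u₂
  newPoint (_ , _ , u₃) = u₃

  newPoint-injective : ∀ fr x y → frameDet fr ≉ 0# → newPoint (advanceFrame x fr) ∼ newPoint (advanceFrame y fr) →
                       (proj₁ x ≈ proj₁ y) × (proj₂ x ≈ proj₂ y)
  newPoint-injective (u₁ , u₂ , u₃) (β , γ) (β′ , γ′) D≉0 (t , _ , t·v≈v′) =
    t≈1⇒x≈y (proj₁ (proj₂ coefficients≈0)) , t≈1⇒x≈y (proj₂ (proj₂ coefficients≈0))
    where
    difference : ∀ x y z → t * ((1# * x + β * y) + γ * z) ≈ (1# * x + β′ * y) + γ′ * z →
                 ((t - 1#) * x + (t * β - 1# * β′) * y) + (t * γ - 1# * γ′) * z ≈ 0#
    difference x y z tv≈v′ = begin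
      ((t - 1#) * x + (t * β - 1# * β′) * y) + (t * γ - 1# * γ′) * z
        ≈⟨ solve 8 (λ t β γ β′ γ′ x y z →
             ((t :- con (+ 1)) :* x :+ (t :* β :- con (+ 1) :* β′) :* y) :+ (t :* γ :- con (+ 1) :* γ′) :* z
             := t :* ((con (+ 1) :* x :+ β :* y) :+ γ :* z) :- ((con (+ 1) :* x :+ β′ :* y) :+ γ′ :* z))
           refl t β γ β′ γ′ x y z ⟩
      t * ((1# * x + β * y) + γ * z) - ((1# * x + β′ * y) + γ′ * z)
        ≈⟨ +-congʳ tv≈v′ ⟩
      ((1# * x + β′ * y) + γ′ * z) - ((1# * x + β′ * y) + γ′ * z)
        ≈⟨ -‿inverseʳ _ ⟩
      0# ∎
    coefficients≈0 : (t - 1# ≈ 0#) × (t * β - 1# * β′ ≈ 0#) × (t * γ - 1# * γ′ ≈ 0#)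
    coefficients≈0 = det≉0⇒LinIndep D≉0 _ _ _
      ( difference (π₁ u₁) (π₁ u₂) (π₁ u₃) (proj₁ t·v≈v′)
      , difference (π₂ u₁) (π₂ u₂) (π₂ u₃) (proj₁ (proj₂ t·v≈v′))
      , difference (π₃ u₁) (π₃ u₂) (π₃ u₃) (proj₂ (proj₂ t·v≈v′)))
    t≈1 : t ≈ 1#
    t≈1 = x-y≈0⇒x≈y (proj₁ coefficients≈0)
    t≈1⇒x≈y : ∀ {x y} → t * x - 1# * y ≈ 0# → x ≈ y
    t≈1⇒x≈y {x} {y} tx-y≈0 = begin
      x      ≈⟨ *-identityˡ x ⟨
      1# * x ≈⟨ *-congʳ t≈1 ⟨
      t * x  ≈⟨ x-y≈0⇒x≈y tx-y≈0 ⟩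
      1# * y ≈⟨ *-identityˡ y ⟩
      y      ∎

  newPoint-onto : ∀ u₁ u₂ u₃ r {β γ} → det u₁ u₂ u₃ ≉ 0# → det u₂ u₃ r ≉ 0# →
                  β ≈ det u₁ r u₃ * det r u₂ u₃ ⁻¹ → γ ≈ det u₁ u₂ r * det r u₂ u₃ ⁻¹ →
                  r ∼ newPoint (advanceFrame (β , γ) (u₁ , u₂ , u₃))
  newPoint-onto u₁ u₂ u₃ r {β} {γ} D≉0 D′≉0 β≈ γ≈ =
    α ⁻¹ * D , x≉0∧y≉0⇒x*y≉0 (x⁻¹≉0 α≉0) D≉0 ,
    component (π₁ u₁) (π₁ u₂) (π₁ u₃) (π₁ r) (proj₁ D·r≈) ,
    component (π₂ u₁) (π₂ u₂) (π₂ u₃) (π₂ r) (proj₁ (proj₂ D·r≈)) ,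
    component (π₃ u₁) (π₃ u₂) (π₃ u₃) (π₃ r) (proj₂ (proj₂ D·r≈))
    where
    D = det u₁ u₂ u₃
    α = det r u₂ u₃
    α≉0 : α ≉ 0#
    α≉0 α≈0 = D′≉0 (trans (trans (det-cyclic u₂ u₃ r) (det-cyclic u₃ r u₂)) α≈0)
    D·r≈ : D · r ≈ⱽ comb α (det u₁ r u₃) (det u₁ u₂ r) u₁ u₂ u₃
    D·r≈ = cramer u₁ u₂ u₃ r
    component : ∀ x y z w → D * w ≈ (α * x + det u₁ r u₃ * y) + det u₁ u₂ r * z →
                (α ⁻¹ * D) * w ≈ (1# * x + β * y) + γ * z
    component x y z w Dw≈ = begin
      (α ⁻¹ * D) * w                                          ≈⟨ *-assoc _ _ _ ⟩
      α ⁻¹ * (D * w)                                          ≈⟨ *-congˡ Dw≈ ⟩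
      α ⁻¹ * ((α * x + det u₁ r u₃ * y) + det u₁ u₂ r * z)
        ≈⟨ solve 7 (λ v a b c x y z → v :* ((a :* x :+ b :* y) :+ c :* z) := ((v :* a) :* x :+ (b :* v) :* y) :+ (c :* v) :* z)
                   refl (α ⁻¹) α (det u₁ r u₃) (det u₁ u₂ r) x y z ⟩
      ((α ⁻¹ * α) * x + (det u₁ r u₃ * α ⁻¹) * y) + (det u₁ u₂ r * α ⁻¹) * z
        ≈⟨ +-cong (+-cong (*-congʳ (x⁻¹*x≈1 α≉0)) (*-congʳ (sym β≈))) (*-congʳ (sym γ≈)) ⟩
      (1# * x + β * y) + γ * z                                ∎

module Configurations {c ℓ} (F : Field c ℓ) (p : ℕ) (card : HasCardinality (Field._≈_ F) (λ _ → ⊤) (suc p)) where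
  open Field F hiding (zero)
  open FiniteSetoid setoid card
  open FieldProperties F _≟_
  open Determinant F _≟_
  open States F _≟_
  open Successors F p card
  open Frames F _≟_
  open ProjectivePlane F card
  open CyclicConfigurations F _≟_
  open ClassCounts p using (classCount; pairCount)

  Pair : Set (c ⊔ ℓ)
  Pair = Lift F × Lift F

  -- Positions beyond the word read an arbitrary letter.
  letterAt : ∀ {m} → Vec Letter m → ℕ → Letter
  letterAt []      _       = 0# , 0#
  letterAt (x ∷ _) zero    = x
  letterAt (_ ∷ w) (suc k) = letterAt w k

  module _ (pr : Pair) where
    private
      A B : V³
      A = proj₁ (proj₁ pr)
      B = proj₁ (proj₂ pr)
    open Tracking A B public

    frameOf : ∀ {m} → Vec Letter m → ℕ → Frame
    frameOf w = frameAt initialFrame (letterAt w)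

    pointOf : ∀ {m} → Vec Letter m → ℕ → V³
    pointOf w k = middle (frameOf w k)

    tuple : ∀ {m} → Vec Letter m → Tuple F (2 ℕ.+ m)
    tuple w i = lift (pointOf w (toℕ i))

    tracks-run : ∀ {m} (w : Vec Letter m) {s fr} → Tracks s fr → Tracks (run s w) (frameAt fr (letterAt w) m)
    tracks-run []      tracking = tracking
    tracks-run (x ∷ w) tracking = tracks-run w (tracks-advance x _ _ tracking)

  ValidPair : Pair → Set (c ⊔ ℓ)
  ValidPair (u , w) = ¬ SamePoint F u w

  isFinal⇒cf : ∀ {c} → T (isFinal c) → c ≡ cf
  isFinal⇒cf {cf} _ = ≡.refl

  module _ (pr : Pair) (valid : ValidPair pr) where
    private
      A B : V³
      A = proj₁ (proj₁ pr)
      B = proj₁ (proj₂ pr)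

    det-complement-pair≉0 : det A B (complement A B) ≉ 0#
    det-complement-pair≉0 = det-complement≉0 (proj₂ (proj₁ pr)) (proj₂ (proj₂ pr)) valid

    frameDet-frameOf≉0 : ∀ {m} (w : Vec Letter m) k → frameDet (frameOf pr w k) ≉ 0#
    frameDet-frameOf≉0 w k D≈0 =
      det-complement-pair≉0 (trans (det-cyclic A B _) (trans (det-cyclic B _ A) (trans (sym (frameDet-frameAt _ (letterAt w) k)) D≈0)))

    pointOf≉0 : ∀ {m} (w : Vec Letter m) k → ¬ (pointOf pr w k ≈ⱽ 0³ F)
    pointOf≉0 w k = det≉0⇒≉0ᵐ (frameDet-frameOf≉0 w k)

    frameOf-suc : ∀ {m} (w : Vec Letter m) k → frameOf pr w (suc k) ≡ advanceFrame (letterAt w k) (frameOf pr w k)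
    frameOf-suc w = frameAt-suc _ (letterAt w)

    pointOf-suc : ∀ {m} (w : Vec Letter m) k → pointOf pr w (suc k) ≡ newPoint (frameOf pr w k)
    pointOf-suc w k = ≡.cong middle (frameOf-suc w k)

    consecutive≉0 : ∀ {m} (w : Vec Letter m) k →
                    det (pointOf pr w k) (pointOf pr w (1 ℕ.+ k)) (pointOf pr w (2 ℕ.+ k)) ≉ 0#
    consecutive≉0 w k = ≡.subst₂ (λ x z → det x (pointOf pr w (1 ℕ.+ k)) z ≉ 0#)
                          (≡.cong proj₁ (frameOf-suc w k)) (≡.sym (pointOf-suc w (suc k)))
                          (frameDet-frameOf≉0 w (suc k))

    tuple-InC₃ : ∀ {m} (w : Vec Letter m) → T (isFinal (class (run (initialState pr) w))) → InC₃ F (2 ℕ.+ m) (tuple pr w)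
    tuple-InC₃ {m} w accepted =
      InC₃-intro m (pointOf pr w) (pointOf≉0 w) (λ k _ → consecutive≉0 w k)
        (≡.subst (λ z → det u₂ z A ≉ 0#) (≡.sym (pointOf-suc w m)) (proj₁ (a₁≉0⇔det≉0 pr _ u₁ u₂ u₃ tracking (frameDet-frameOf≉0 w m)) a₁≉0))
        (≡.subst (λ z → det z A B ≉ 0#) (≡.sym (pointOf-suc w m)) (proj₁ (l₃≉0⇔det≉0 pr _ u₁ u₂ u₃ tracking) l₃≉0))
      where
      s = run (initialState pr) w
      u₁ = proj₁ (frameOf pr w m)
      u₂ = middle (frameOf pr w m)
      u₃ = newPoint (frameOf pr w m)
      tracking : Tracks pr s (u₁ , u₂ , u₃)
      tracking = tracks-run pr w (tracks-initial pr)
      final : HasClass s cf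
      final = ≡.subst (HasClass s) (isFinal⇒cf accepted) (hasClass-class s)
      a₁≉0 : a₁ s ≉ 0#
      a₁≉0 = proj₁ final
      l₃≉0 : l₃ s ≉ 0#
      l₃≉0 = proj₂ final

  configurations : ∀ m → List (Tuple F (2 ℕ.+ m))
  configurations m = concatMap (λ pr → map (tuple pr) (words m (initialState pr))) (distinctPairs points)

  pairs-valid : All ValidPair (distinctPairs points)
  pairs-valid = distinctPairs-related (λ u≁w w∼u → u≁w (∼-sym w∼u)) points-distinct

  length-configurations : ∀ m → length (configurations m) ≡ pairCount ℕ.* classCount m cc
  length-configurations m = begin
    length (configurations m)
      ≡⟨ length-concatMap _ (distinctPairs points) ⟩
    sum (map (length ∘ (λ pr → map (tuple pr) (words m (initialState pr)))) (distinctPairs points))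
      ≡⟨ sum-map-const _ (All.map (λ {pr} valid → words-count pr valid) pairs-valid) ⟩
    length (distinctPairs points) ℕ.* classCount m cc
      ≡⟨ ≡.cong (ℕ._* classCount m cc) (≡.trans (length-distinctPairs points) (≡.cong (λ l → l ℕ.* ℕ.pred l) length-points)) ⟩
    pairCount ℕ.* classCount m cc ∎
    where
    open ≡.≡-Reasoning
    words-count : ∀ pr → ValidPair pr → length (map (tuple pr) (words m (initialState pr))) ≡ classCount m cc
    words-count pr valid = ≡.trans (length-map (tuple pr) (words m (initialState pr)))
      (≡.trans (length-words m _ (invariant-initial pr (det-complement-pair≉0 pr valid))) (≡.cong (classCount m) (class-initial pr)))

  configurations-InC₃ : ∀ m → All (InC₃ F (2 ℕ.+ m)) (configurations m)
  configurations-InC₃ m = All.concat⁺ (All.map⁺ (All.map (λ {pr} valid →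
    All.map⁺ (All.map (λ {w} → tuple-InC₃ pr valid w) (words-accepted m (initialState pr)))) pairs-valid))

  infix 4 _≉ᴸ_
  _≉ᴸ_ : Letter → Letter → Set ℓ
  x ≉ᴸ y = ¬ ((proj₁ x ≈ proj₁ y) × (proj₂ x ≈ proj₂ y))

  letters-distinct : AllPairs _≉ᴸ_ letters
  letters-distinct = Unique.cartesianProduct⁺ setoid setoid elements-distinct elements-distinct

  newPoints-differ : ∀ {m} fr (w w′ : Vec Letter m) → frameDet fr ≉ 0# → FirstDifference _≉ᴸ_ w w′ →
                     ∃ λ k → k < m × ¬ (newPoint (frameAt fr (letterAt w) (suc k)) ∼ newPoint (frameAt fr (letterAt w′) (suc k)))
  newPoints-differ fr (x ∷ _) (y ∷ _) D≉0 (here x≉y) = 0 , s≤s z≤n , λ x∼y → x≉y (newPoint-injective fr x y D≉0 x∼y)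
  newPoints-differ fr (x ∷ w) (.x ∷ w′) D≉0 (there difference) =
    let (k , k<m , ≁) = newPoints-differ (advanceFrame x fr) w w′ (λ D′≈0 → D≉0 (trans (sym (frameDet-advance x fr)) D′≈0)) difference
    in suc k , s≤s k<m , ≁

  private
    same-at : ∀ {n} {vs ws : Tuple F n} i → SameTuple F n vs ws → ∀ {u w} → proj₁ (vs i) ≡ u → proj₁ (ws i) ≡ w → u ∼ w
    same-at i same ≡.refl ≡.refl = same i

  tuples-differ-by-word : ∀ pr → ValidPair pr → ∀ {m} {w w′ : Vec Letter m} → FirstDifference _≉ᴸ_ w w′ →
                          ¬ SameTuple F (2 ℕ.+ m) (tuple pr w) (tuple pr w′)
  tuples-differ-by-word pr valid {m} {w} {w′} difference same =
    let (k , k<m , ≁) = newPoints-differ _ w w′ (frameDet-frameOf≉0 pr valid w 0) difference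
        i = fromℕ< (s≤s (s≤s k<m))
    in ≁ (same-at {vs = tuple pr w} {ws = tuple pr w′} i same (at i w {k} (toℕ-fromℕ< (s≤s (s≤s k<m)))) (at i w′ {k} (toℕ-fromℕ< (s≤s (s≤s k<m)))))
    where
    at : ∀ i v {k} → toℕ i ≡ suc (suc k) → proj₁ (tuple pr v i) ≡ newPoint (frameOf pr v (suc k))
    at i v {k} i≡ = ≡.trans (lift-≉0 (pointOf≉0 pr valid v (toℕ i))) (≡.trans (≡.cong (pointOf pr v) i≡) (pointOf-suc pr valid v (suc k)))

  tuples-differ-by-pair : ∀ pr pr′ {m} (w w′ : Vec Letter m) →
                          ¬ SamePoint F (proj₁ pr) (proj₁ pr′) ⊎ ¬ SamePoint F (proj₂ pr) (proj₂ pr′) →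
                          ¬ SameTuple F (2 ℕ.+ m) (tuple pr w) (tuple pr′ w′)
  tuples-differ-by-pair pr pr′ w w′ (inj₁ first≁) same =
    first≁ (same-at {vs = tuple pr w} {ws = tuple pr′ w′} Fin.zero same (lift-≉0 (proj₂ (proj₁ pr))) (lift-≉0 (proj₂ (proj₁ pr′))))
  tuples-differ-by-pair pr pr′ w w′ (inj₂ second≁) same =
    second≁ (same-at {vs = tuple pr w} {ws = tuple pr′ w′} (Fin.suc Fin.zero) same (lift-≉0 (proj₂ (proj₂ pr))) (lift-≉0 (proj₂ (proj₂ pr′))))

  configurations-distinct : ∀ m → AllPairs (λ vs ws → ¬ SameTuple F (2 ℕ.+ m) vs ws) (configurations m)
  configurations-distinct m = AllPairs.concat⁺
    (All.map⁺ (All.map (λ {pr} valid → AllPairs.map⁺ (AllPairs.map (tuples-differ-by-word pr valid)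
                                          (words-distinct _≉ᴸ_ letters-distinct m (initialState pr)))) pairs-valid))
    (AllPairs.map⁺ (AllPairs.map (λ {pr} {pr′} different →
      All.map⁺ (All.universal (λ w → All.map⁺ (All.universal (λ w′ → tuples-differ-by-pair pr pr′ w w′ different) _)) _))
      (distinctPairs-distinct points-distinct)))

  -- Cramer's rule, see `newPoint-onto`.
  coefficients : Frame → V³ → Letter
  coefficients (u₁ , u₂ , u₃) r = representative (det u₁ r u₃ * det r u₂ u₃ ⁻¹) , representative (det u₁ u₂ r * det r u₂ u₃ ⁻¹)

  extractWord : (m : ℕ) → Frame → (ℕ → V³) → Vec Letter m
  extractWord zero    fr P = []
  extractWord (suc m) fr P = coefficients fr (P 0) ∷ extractWord m (advanceFrame (coefficients fr (P 0)) fr) (P ∘ suc)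

  extractWord-letters : ∀ m fr P → Vec.All (_∈ letters) (extractWord m fr P)
  extractWord-letters zero    fr P = Vec.[]
  extractWord-letters (suc m) fr@(u₁ , u₂ , u₃) P =
    Any.cartesianProductWith⁺ _,_ (≡.cong₂ _,_) (representative-∈ _) (representative-∈ _) Vec.∷ extractWord-letters m _ (P ∘ suc)

  extractWord-tracks : ∀ m fr (P : ℕ → V³) → frameDet fr ≉ 0# → P 0 ∼ middle fr → P 1 ∼ newPoint fr →
                       (∀ k → k < m → det (P k) (P (1 ℕ.+ k)) (P (2 ℕ.+ k)) ≉ 0#) →
                       let w = extractWord m fr (P ∘ suc ∘ suc) in
                       ∀ k → k ≤ m → P k ∼ middle (frameAt fr (letterAt w) k) × P (1 ℕ.+ k) ∼ newPoint (frameAt fr (letterAt w) k)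
  extractWord-tracks m       fr P D≉0 P₀∼ P₁∼ consecutive zero    _         = P₀∼ , P₁∼
  extractWord-tracks (suc m) fr@(u₁ , u₂ , u₃) P D≉0 P₀∼ P₁∼ consecutive (suc k) (s≤s k≤m) =
    extractWord-tracks m (advanceFrame x fr) (P ∘ suc) D′≉0 P₁∼ P₂∼ (λ j j<m → consecutive (suc j) (s≤s j<m)) k k≤m
    where
    x = coefficients fr (P 2)
    D′≉0 : frameDet (advanceFrame x fr) ≉ 0#
    D′≉0 D′≈0 = D≉0 (trans (sym (frameDet-advance x fr)) D′≈0)
    P₂∼ : P 2 ∼ newPoint (advanceFrame x fr)
    P₂∼ = newPoint-onto u₁ u₂ u₃ (P 2) D≉0 (det-∼ᵐ u₂ (P 2) P₁∼ (det-∼ˡ (P 1) (P 2) P₀∼ (consecutive 0 (s≤s z≤n))))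
            (sym (≈-representative _)) (sym (≈-representative _))

  module Completeness {m} (vs : Tuple F (2 ℕ.+ m)) (inC₃ : InC₃ F (2 ℕ.+ m) vs) where
    private
      n = 2 ℕ.+ m

      P : ℕ → V³
      P = point vs

      consecutive : ∀ k → k < n → det (P k) (P (1 ℕ.+ k)) (P (2 ℕ.+ k)) ≉ 0#
      consecutive = InC₃-elim vs inC₃

      ∼-subst : ∀ {u u′ w w′} → u ≡ u′ → w ≡ w′ → u ∼ w → u′ ∼ w′
      ∼-subst ≡.refl ≡.refl u∼w = u∼w

    pair∈ : Any (λ pr → P 0 ∼ proj₁ (proj₁ pr) × P 1 ∼ proj₁ (proj₂ pr)) (distinctPairs points)
    pair∈ = distinctPairs-any (λ P₀∼x P₁∼x → consecutive 0 (s≤s z≤n) (∼⇒det≈0 (P 2) (∼-trans P₀∼x (∼-sym P₁∼x))))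
                              (∈-points (vs (0 mod n))) (∈-points (vs (1 mod n)))

    module _ (pr : Pair) (P₀∼A : P 0 ∼ proj₁ (proj₁ pr)) (P₁∼B : P 1 ∼ proj₁ (proj₂ pr)) where
      private
        A B : V³
        A = proj₁ (proj₁ pr)
        B = proj₁ (proj₂ pr)

      valid : ValidPair pr
      valid A∼B = consecutive 0 (s≤s z≤n) (∼⇒det≈0 (P 2) (∼-trans P₀∼A (∼-trans A∼B (∼-sym P₁∼B))))

      word : Vec Letter m
      word = extractWord m (initialFrame pr) (P ∘ suc ∘ suc)

      tracks : ∀ k → k ≤ m → P k ∼ pointOf pr word k × P (1 ℕ.+ k) ∼ newPoint (frameOf pr word k)
      tracks = extractWord-tracks m (initialFrame pr) P (frameDet-frameOf≉0 pr valid word 0) P₀∼A P₁∼B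
                 (λ k k<m → consecutive k (ℕ.<-trans k<m (ℕ.<-trans (ℕ.n<1+n m) (ℕ.n<1+n (suc m)))))

      accepted : T (isFinal (class (run (initialState pr) word)))
      accepted = ≡.subst (T ∘ isFinal) (≡.sym (class-hasClass s cf (a₁≉0 , l₃≉0))) _
        where
        s = run (initialState pr) word
        fr = frameOf pr word m
        u₁ = proj₁ fr
        u₂ = middle fr
        u₃ = newPoint fr
        tracking : Tracks pr s (u₁ , u₂ , u₃)
        tracking = tracks-run pr word (tracks-initial pr)
        Pₘ∼u₂ : P m ∼ u₂
        Pₘ∼u₂ = proj₁ (tracks m ℕ.≤-refl)
        P₁₊ₘ∼u₃ : P (1 ℕ.+ m) ∼ u₃
        P₁₊ₘ∼u₃ = proj₂ (tracks m ℕ.≤-refl)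
        a₁≉0 : a₁ s ≉ 0#
        a₁≉0 = proj₂ (a₁≉0⇔det≉0 pr s u₁ u₂ u₃ tracking (frameDet-frameOf≉0 pr valid word m))
          (det-∼ʳ u₂ u₃ P₀∼A (det-∼ᵐ u₂ (P 0) P₁₊ₘ∼u₃ (det-∼ˡ (P (1 ℕ.+ m)) (P 0) Pₘ∼u₂
             (≡.subst (λ z → det (P m) (P (1 ℕ.+ m)) z ≉ 0#) (point-+n vs 0) (consecutive m (ℕ.<-trans (ℕ.n<1+n m) (ℕ.n<1+n (suc m))))))))
        l₃≉0 : l₃ s ≉ 0#
        l₃≉0 = proj₂ (l₃≉0⇔det≉0 pr s u₁ u₂ u₃ tracking)
          (det-∼ʳ u₃ A P₁∼B (det-∼ᵐ u₃ (P 1) P₀∼A (det-∼ˡ (P 0) (P 1) P₁₊ₘ∼u₃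
             (≡.subst₂ (λ y z → det (P (1 ℕ.+ m)) y z ≉ 0#) (point-+n vs 0) (point-+n vs 1) (consecutive (1 ℕ.+ m) (ℕ.n<1+n (suc m)))))))

      word∈ : word ∈ words m (initialState pr)
      word∈ = ∈-words (initialState pr) word (extractWord-letters m (initialFrame pr) (P ∘ suc ∘ suc)) accepted

      same : SameTuple F n vs (tuple pr word)
      same i = ∼-subst (point-toℕ vs i) (≡.sym (lift-≉0 (pointOf≉0 pr valid word (toℕ i)))) (at (toℕ i) (toℕ<n i))
        where
        at : ∀ k → k < n → P k ∼ pointOf pr word k
        at k k<n with ℕ.m<1+n⇒m<n∨m≡n k<n
        ... | inj₁ (s≤s k≤m) = proj₁ (tracks k k≤m)
        ... | inj₂ ≡.refl    = ∼-subst ≡.refl (≡.sym (pointOf-suc pr valid word m)) (proj₂ (tracks m ℕ.≤-refl))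

    complete : Any (SameTuple F n vs) (configurations m)
    complete = Any.concatMap⁺ _ (Any.map (λ {pr} (P₀∼A , P₁∼B) →
                 Any.map⁺ (Any.map (λ { ≡.refl → same pr P₀∼A P₁∼B }) (word∈ pr P₀∼A P₁∼B))) pair∈)

import Data.Nat
open import Data.Integer using (_+_; _-_; _*_; _^_)

theorem3p3 : ∀ {c ℓ : Level} (F : Field c ℓ) (q n : ℕ) → 3 ≤ n →
    HasCardinality (Field._≈_ F) (λ _ → ⊤) q →
    ∃ λ N → HasCardinality (SameTuple F n) (InC₃ F n) N ×
      ((¬ (n % 3 ≡ 0) →
          + N ≡ (((+ q) ^ (2 Data.Nat.* n) - (+ q) ^ (n Data.Nat.+ 2)) - (+ q) ^ (n Data.Nat.+ 1)) + (+ q) ^ 3) ×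
       (n % 3 ≡ 0 →
          + N ≡ (((+ q) ^ (2 Data.Nat.* n) + + 2 * (+ q) ^ (n Data.Nat.+ 2)) + + 2 * (+ q) ^ (n Data.Nat.+ 1)) + (+ q) ^ 3))
theorem3p3 F zero n _ card with FiniteSetoid.N≡suc[pred] (Field.setoid F) card (Field.0# F)
... | ()
theorem3p3 F (suc p) (suc (suc (suc k))) (s≤s (s≤s (s≤s _))) card =
  pairCount ℕ.* classCount m cc ,
  (configurations m , length-configurations m , configurations-InC₃ m , configurations-distinct m ,
   λ vs inC₃ → Completeness.complete vs inC₃) ,
  pairCount*classCount-cc m
  where
  m = suc k
  open ClassCounts p
  open Configurations F p card
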